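{- Let $n\ge 3$ be an integer and let $I$ be a degree-based topological index with coefficients $c_{12},c_{13},c_{22},c_{23},c_{33}\in\mathbb{R}$. Define $c'_{12}=c_{12}-4c_{22}+3c_{23}$, $c'_{13}=c_{13}-3c_{22}+2c_{23}$, $c'_{33}=c_{22}-2c_{23}+c_{33}$. If $c'_{13}<c'_{12}<-c'_{33}<0$, then the path $P_n$ on $n$ vertices is the only tree in $\mathcal{G}_3(n,n-1)$ that maximizes $I$.
   Context: For integers $n,m$, $\mathcal{G}_3(n,m)$ denotes the set of simple connected undirected graphs with $n$ vertices, $m$ edges and maximum degree at most $3$ (chemical graphs); thus $\mathcal{G}_3(n,n-1)$ is the set of trees on $n$ vertices with maximum degree at most $3$. For a graph $G$ and $1\le i\le j$, an $ij$-edge is an edge whose endpoints have degrees $i$ and $j$, and $m_{ij}$ is the number of $ij$-edges of $G$. A degree-based topological index $I$ with coefficients $c_{ij}$ assigns to $G\in\mathcal{G}_3(n,m)$, $n\ge 3$, the value $I(G)=c_{12}m_{12}+c_{13}m_{13}+c_{22}m_{22}+c_{23}m_{23}+c_{33}m_{33}$. Graphs are considered up to isomorphism. -}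

module Defs where

open import Level using (Level; _⊔_) renaming (suc to lsuc)
open import Data.Nat as ℕ using (ℕ; zero; suc; _≡ᵇ_; _<ᵇ_)
open import Data.Bool using (Bool; true; false; _∨_; _∧_; if_then_else_)
open import Data.Bool.Properties using (∨-comm)
open import Data.Fin using (Fin; toℕ)
open import Data.List using (List; []; _∷_; map; concatMap; allFin)
open import Data.Product using (∃; _×_)
open import Data.Sum using (_⊎_)
open import Function.Bundles using (_↔_; Inverse)
open import Relation.Binary.Core using (Rel)
open import Relation.Binary.Structures using (IsStrictTotalOrder)
open import Relation.Binary.PropositionalEquality using (_≡_; refl)
open import Relation.Nullary using (¬_)
open import Algebra.Bundles using (CommutativeRing)

-- Ordered fields (stand-in for ℝ, which agda-stdlib lacks).

record OrderedField (c ℓ : Level) : Set (lsuc (c ⊔ ℓ)) where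
  field
    commutativeRing : CommutativeRing c ℓ
  open CommutativeRing commutativeRing public
  infix 4 _<_
  field
    _<_                : Rel Carrier ℓ
    isStrictTotalOrder : IsStrictTotalOrder _≈_ _<_
    0<1                : 0# < 1#
    +-mono-<           : ∀ {x y} z → x < y → (x + z) < (y + z)
    *-pos              : ∀ {x y} → 0# < x → 0# < y → 0# < (x * y)
    inverse            : ∀ x → ¬ (x ≈ 0#) → ∃ λ y → (x * y) ≈ 1#

  infix 4 _≤_
  _≤_ : Rel Carrier ℓ
  x ≤ y = (x < y) ⊎ (x ≈ y)

  infixr 8 _·_
  _·_ : ℕ → Carrier → Carrier
  zero  · x = 0#
  suc k · x = x + k · x

record Graph (n : ℕ) : Set where
  field
    adj    : Fin n → Fin n → Bool
    sym    : ∀ u v → adj u v ≡ adj v u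
    irrefl : ∀ u → adj u u ≡ false
open Graph public

countTrue : List Bool → ℕ
countTrue []           = 0
countTrue (true ∷ bs)  = suc (countTrue bs)
countTrue (false ∷ bs) = countTrue bs

pairs : (n : ℕ) → List (Fin n × Fin n)
pairs n = concatMap (λ u → concatMap (λ v → if toℕ u <ᵇ toℕ v then (u Data.Product., v) ∷ [] else []) (allFin n)) (allFin n)

degree : ∀ {n} → Graph n → Fin n → ℕ
degree {n} G u = countTrue (map (adj G u) (allFin n))

numEdges : ∀ {n} → Graph n → ℕ
numEdges {n} G = countTrue (map (λ p → adj G (Data.Product.proj₁ p) (Data.Product.proj₂ p)) (pairs n))

m : ∀ {n} → Graph n → ℕ → ℕ → ℕ
m {n} G i j = countTrue (map test (pairs n))
  where
  test : Fin n × Fin n → Bool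
  test (u Data.Product., v) =
    adj G u v ∧ (((degree G u ≡ᵇ i) ∧ (degree G v ≡ᵇ j)) ∨ ((degree G u ≡ᵇ j) ∧ (degree G v ≡ᵇ i)))

data Reachable {n} (G : Graph n) : Fin n → Fin n → Set where
  here : ∀ {u} → Reachable G u u
  step : ∀ {u w v} → adj G u w ≡ true → Reachable G w v → Reachable G u v

Connected : ∀ {n} → Graph n → Set
Connected G = ∀ u v → Reachable G u v

MaxDegreeAtMost3 : ∀ {n} → Graph n → Set
MaxDegreeAtMost3 G = ∀ u → degree G u ℕ.≤ 3

InG3 : (n e : ℕ) → Graph n → Set
InG3 n e G = Connected G × MaxDegreeAtMost3 G × numEdges G ≡ e

IsChemTree : (n : ℕ) → Graph n → Set
IsChemTree n G = InG3 n (n ℕ.∸ 1) G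

record _≅_ {n} (G H : Graph n) : Set where
  field
    bij      : Fin n ↔ Fin n
    preserve : ∀ u v → adj H (Inverse.to bij u) (Inverse.to bij v) ≡ adj G u v

private
  ≡ᵇ-suc : ∀ k → (k ≡ᵇ suc k) ≡ false
  ≡ᵇ-suc zero    = refl
  ≡ᵇ-suc (suc k) = ≡ᵇ-suc k

pathAdj : ∀ {n} → Fin n → Fin n → Bool
pathAdj u v = (toℕ u ≡ᵇ suc (toℕ v)) ∨ (toℕ v ≡ᵇ suc (toℕ u))

path : (n : ℕ) → Graph n
path n = record
  { adj    = pathAdj
  ; sym    = λ u v → ∨-comm (toℕ u ≡ᵇ suc (toℕ v)) (toℕ v ≡ᵇ suc (toℕ u))
  ; irrefl = λ u → irr u
  }
  where
  irr : (u : Fin n) → pathAdj u u ≡ false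
  irr u rewrite ≡ᵇ-suc (toℕ u) = refl

module _ {c ℓ : Level} (F : OrderedField c ℓ) where
  open OrderedField F

  index : (c12 c13 c22 c23 c33 : Carrier) → ∀ {n} → Graph n → Carrier
  index c12 c13 c22 c23 c33 G =
    (m G 1 2 · c12) + (m G 1 3 · c13) + (m G 2 2 · c22) + (m G 2 3 · c23) + (m G 3 3 · c33)

-- Counting edge ends at the vertices of each degree shows that a chemical tree T on n ≥ 3
-- vertices, n₃ of them of degree 3, has no 11-edges and satisfies
--   m₁₂ + m₁₃ = n₃ + 2,   m₁₃ + m₂₃ + 2 m₃₃ = 3 n₃,   m₁₂ + m₁₃ + m₂₂ + m₂₃ + m₃₃ = n − 1.
-- Rooted at a vertex of degree 3, the parent map sends the 33-edges injectively to non-root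
-- vertices of degree 3, so m₃₃ < n₃ when n₃ > 0; rooted at a leaf, a tree without vertices of
-- degree 3 has one vertex per level and is the path.  Eliminating m₂₂ and m₂₃ gives
--   I(Pₙ) − I(T) = (n₃ − m₃₃) (− c′₁₂) + m₁₃ (c′₁₂ − c′₁₃) + m₃₃ (− c′₁₂ − c′₃₃),
-- and every bracket is positive by hypothesis.  The identity is used in subtraction-free form:
-- the counts of T plus a vector V equal the counts of Pₙ plus a vector U, where U and V are
-- sums of multiples of three pairs of vectors whose weights compare as the hypotheses say.

module Submission where

open import Defs renaming (sym to adj-sym)
open import Level using (Level)
open import Data.Nat using (ℕ; _≥_)
open import Data.Product using (_×_; _,_; proj₁; proj₂)
open import Relation.Nullary using (¬_)
open import Data.Sum using (inj₁; inj₂)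
open import Data.Empty using (⊥-elim)
import Data.Nat as ℕ
import Relation.Binary.PropositionalEquality as ≡

module Combinatorics where

  open import Data.Bool using (Bool; true; false; _∧_; _∨_; not; if_then_else_; T)
  open import Data.Bool.Properties using (∧-comm; ∧-assoc; ∧-identityʳ; ∧-zeroʳ; ∨-comm; ∨-idem)
  open import Data.Fin using (Fin; toℕ; fromℕ<; inject₁; punchOut) renaming (zero to fzero; suc to fsuc)
  open import Data.Fin.Properties
    using (any?; punchOut-injective; injective⇒≤; toℕ-injective; toℕ<n; toℕ-fromℕ<; toℕ-inject₁)
    renaming (_≟_ to _≟ᶠ_)
  open import Data.List using (List; []; _∷_; _++_; map; concatMap; tabulate)
  open import Data.Nat
    using (zero; suc; _+_; _*_; _∸_; _≤_; _<_; z≤n; s≤s; s≤s⁻¹; _≤′_; ≤′-refl; ≤′-step; _≡ᵇ_; _<ᵇ_)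
  open import Data.Nat.Properties
  open import Data.Nat.Tactic.RingSolver using (solve-∀; solve)
  open import Data.Product using (∃)
  open import Data.Sum using (_⊎_)
  open import Function using (_∘_; id; case_of_)
  open import Function.Bundles using (mk↔ₛ′)
  open import Relation.Binary.Definitions using (tri<; tri≈; tri>)
  open import Relation.Binary.PropositionalEquality
  open import Relation.Nullary using (¬_; Dec; yes; no; does)
  open import Relation.Nullary.Decidable using (T?)
  open import Algebra.Properties.Semiring.Sum +-*-semiring
    using (sum; sum-cong-≗; ∑-distrib-+; ∑-comm; *-distribˡ-sum; sum-replicate-zero)

  -- Indicator sums over Fin n

  ⟦_⟧ : Bool → ℕ
  ⟦ true  ⟧ = 1
  ⟦ false ⟧ = 0

  ⟦⟧≤1 : ∀ b → ⟦ b ⟧ ≤ 1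
  ⟦⟧≤1 true  = s≤s z≤n
  ⟦⟧≤1 false = z≤n

  ⟦⟧-≥1 : ∀ {b} → 1 ≤ ⟦ b ⟧ → b ≡ true
  ⟦⟧-≥1 {true} _ = refl


  ⟦⟧-injective : ∀ {a b} → ⟦ a ⟧ ≡ ⟦ b ⟧ → a ≡ b
  ⟦⟧-injective {true}  {true}  _ = refl
  ⟦⟧-injective {false} {false} _ = refl

  ⟦⟧-∨ : ∀ a b → (a ∧ b) ≢ true → ⟦ a ∨ b ⟧ ≡ ⟦ a ⟧ + ⟦ b ⟧
  ⟦⟧-∨ true  true  a∧b≢true = ⊥-elim (a∧b≢true refl)
  ⟦⟧-∨ true  false _        = refl
  ⟦⟧-∨ false b     _        = refl

  ⟦⟧-∨-≤ : ∀ a b → ⟦ a ∨ b ⟧ ≤ ⟦ a ⟧ + ⟦ b ⟧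
  ⟦⟧-∨-≤ true  b = s≤s z≤n
  ⟦⟧-∨-≤ false b = ≤-refl

  ⟦⟧-∨∧ : ∀ a b x → (a ∧ b) ≢ true → ⟦ (a ∨ b) ∧ x ⟧ ≡ ⟦ a ∧ x ⟧ + ⟦ b ∧ x ⟧
  ⟦⟧-∨∧ true  true  x a∧b≢true = ⊥-elim (a∧b≢true refl)
  ⟦⟧-∨∧ true  false x _        = sym (+-identityʳ ⟦ x ⟧)
  ⟦⟧-∨∧ false b     x _        = refl

  ⟦⟧-∨-disjoint : ∀ a x y x′ y′ → (x ∧ x′) ≢ true →
    ⟦ a ∧ ((x ∧ y) ∨ (x′ ∧ y′)) ⟧ ≡ ⟦ a ∧ (x ∧ y) ⟧ + ⟦ a ∧ (y′ ∧ x′) ⟧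
  ⟦⟧-∨-disjoint false _     _     _     _     _    = refl
  ⟦⟧-∨-disjoint true  true  _     true  _     excl = ⊥-elim (excl refl)
  ⟦⟧-∨-disjoint true  true  true  false true  _    = refl
  ⟦⟧-∨-disjoint true  true  true  false false _    = refl
  ⟦⟧-∨-disjoint true  true  false false true  _    = refl
  ⟦⟧-∨-disjoint true  true  false false false _    = refl
  ⟦⟧-∨-disjoint true  false _     true  true  _    = refl
  ⟦⟧-∨-disjoint true  false _     true  false _    = refl
  ⟦⟧-∨-disjoint true  false _     false true  _    = refl
  ⟦⟧-∨-disjoint true  false _     false false _    = refl

  ⟦⟧-split : ∀ a b → ⟦ a ∧ b ⟧ + ⟦ not a ∧ b ⟧ ≡ ⟦ b ⟧
  ⟦⟧-split true  b = +-identityʳ ⟦ b ⟧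
  ⟦⟧-split false b = refl

  ⟦⟧-∧-weaken : ∀ a x y → ⟦ a ∧ (x ∧ y) ⟧ ≤ ⟦ a ∧ y ⟧
  ⟦⟧-∧-weaken false _     _ = z≤n
  ⟦⟧-∧-weaken true  false _ = z≤n
  ⟦⟧-∧-weaken true  true  y = ≤-refl

  ∧-true : ∀ {a b} → (a ∧ b) ≡ true → a ≡ true × b ≡ true
  ∧-true {true} {true} _ = refl , refl

  T⇒≡true : ∀ {b} → T b → b ≡ true
  T⇒≡true {true} _ = refl

  ≡true⇒T : ∀ {b} → b ≡ true → T b
  ≡true⇒T refl = _

  does⇒witness : ∀ {A : Set} (a? : Dec A) → does a? ≡ true → A
  does⇒witness (yes a) _ = a

  witness⇒does : ∀ {A : Set} (a? : Dec A) → A → does a? ≡ true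
  witness⇒does (yes _)  _ = refl
  witness⇒does (no ¬a) a = ⊥-elim (¬a a)

  does-false : ∀ {A : Set} (a? : Dec A) → ¬ A → does a? ≡ false
  does-false (yes a) ¬a = ⊥-elim (¬a a)
  does-false (no _)  _  = refl

  not-true : ∀ {A : Set} (a? : Dec A) → not (does a?) ≡ true → ¬ A
  not-true (no ¬a) _ = ¬a

  sum-ones : ∀ n → sum {n} (λ _ → 1) ≡ n
  sum-ones zero    = refl
  sum-ones (suc n) = cong suc (sum-ones n)

  sum-≡0 : ∀ {n} (f : Fin n → ℕ) → (∀ i → f i ≡ 0) → sum f ≡ 0
  sum-≡0 {zero}  f f≡0 = refl
  sum-≡0 {suc n} f f≡0 = cong₂ _+_ (f≡0 fzero) (sum-≡0 (f ∘ fsuc) (f≡0 ∘ fsuc))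

  sum-mono : ∀ {n} {f g : Fin n → ℕ} → (∀ i → f i ≤ g i) → sum f ≤ sum g
  sum-mono {zero}  _   = z≤n
  sum-mono {suc n} f≤g = +-mono-≤ (f≤g fzero) (sum-mono (f≤g ∘ fsuc))

  +-mono-≤-≡ : ∀ {a b c d} → a ≤ b → c ≤ d → a + c ≡ b + d → a ≡ b × c ≡ d
  +-mono-≤-≡ {a} {b} {c} {d} a≤b c≤d eq = a≡b , +-cancelˡ-≡ a c d (trans eq (cong (_+ d) (sym a≡b)))
    where
    a≡b : a ≡ b
    a≡b = ≤-antisym a≤b (+-cancelʳ-≤ c b a (≤-trans (+-monoʳ-≤ b c≤d) (≤-reflexive (sym eq))))

  sum-mono-≡ : ∀ {n} {f g : Fin n → ℕ} → (∀ i → f i ≤ g i) → sum f ≡ sum g → ∀ i → f i ≡ g i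
  sum-mono-≡ {suc n} f≤g eq i with +-mono-≤-≡ (f≤g fzero) (sum-mono (f≤g ∘ fsuc)) eq
  sum-mono-≡ {suc n} f≤g eq fzero    | head≡ , _     = head≡
  sum-mono-≡ {suc n} f≤g eq (fsuc i) | _     , tail≡ = sum-mono-≡ (f≤g ∘ fsuc) tail≡ i

  term≤sum : ∀ {n} (f : Fin n → ℕ) x → f x ≤ sum f
  term≤sum f fzero    = m≤m+n (f fzero) _
  term≤sum f (fsuc x) = ≤-trans (term≤sum (f ∘ fsuc) x) (m≤n+m _ (f fzero))

  two≤sum : ∀ {n} (f : Fin n → ℕ) {x y} → x ≢ y → 1 ≤ f x → 1 ≤ f y → 2 ≤ sum f
  two≤sum f {fzero}  {fzero}  x≢y _ _ = ⊥-elim (x≢y refl)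
  two≤sum f {fzero}  {fsuc y} _ fx fy = +-mono-≤ fx (≤-trans fy (term≤sum (f ∘ fsuc) y))
  two≤sum f {fsuc x} {fzero}  _ fx fy = +-mono-≤ fy (≤-trans fx (term≤sum (f ∘ fsuc) x))
  two≤sum f {fsuc x} {fsuc y} x≢y fx fy = ≤-trans (two≤sum (f ∘ fsuc) (x≢y ∘ cong fsuc) fx fy) (m≤n+m _ (f fzero))

  sum-pos : ∀ {n} (f : Fin n → ℕ) → 1 ≤ sum f → ∃ λ x → 1 ≤ f x
  sum-pos {suc n} f pos with f fzero in f0
  ... | suc _ = fzero , subst (1 ≤_) (sym f0) (s≤s z≤n)
  ... | zero with sum-pos (f ∘ fsuc) pos
  ...   | x , fx = fsuc x , fx

  sum-point : ∀ {n} (x : Fin n) (b : Fin n → Bool) → sum (λ u → ⟦ does (u ≟ᶠ x) ∧ b u ⟧) ≡ ⟦ b x ⟧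
  sum-point {suc n} fzero    b = trans (cong (⟦ b fzero ⟧ +_) (sum-replicate-zero n)) (+-identityʳ _)
  sum-point {suc n} (fsuc x) b = sum-point x (b ∘ fsuc)

  sum-split : ∀ {n} (a b : Fin n → Bool) →
    sum (λ u → ⟦ a u ∧ b u ⟧) + sum (λ u → ⟦ not (a u) ∧ b u ⟧) ≡ sum (λ u → ⟦ b u ⟧)
  sum-split a b = trans (sym (∑-distrib-+ (λ u → ⟦ a u ∧ b u ⟧) (λ u → ⟦ not (a u) ∧ b u ⟧))) (sum-cong-≗ λ u → ⟦⟧-split (a u) (b u))

  sum-others : ∀ {n} (x : Fin n) → 1 + sum (λ u → ⟦ not (does (u ≟ᶠ x)) ⟧) ≡ n
  sum-others {n} x = begin
    1 + others                              ≡⟨ cong (_+ others) (sym (sum-point x λ _ → true)) ⟩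
    sum (λ u → ⟦ does (u ≟ᶠ x) ∧ true ⟧) + others
      ≡⟨ cong (sum (λ u → ⟦ does (u ≟ᶠ x) ∧ true ⟧) +_) (sum-cong-≗ λ u → cong ⟦_⟧ (sym (∧-identityʳ (not (does (u ≟ᶠ x)))))) ⟩
    sum (λ u → ⟦ does (u ≟ᶠ x) ∧ true ⟧) + sum (λ u → ⟦ not (does (u ≟ᶠ x)) ∧ true ⟧)
                                            ≡⟨ sum-split (λ u → does (u ≟ᶠ x)) (λ _ → true) ⟩
    sum {n} (λ _ → 1)                       ≡⟨ sum-ones n ⟩
    n                                       ∎
    where
    open ≡-Reasoning
    others = sum (λ u → ⟦ not (does (u ≟ᶠ x)) ⟧)

  avoid-two : ∀ {n} → 3 ≤ n → (u v : Fin n) → ∃ λ w → w ≢ u × w ≢ v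
  avoid-two {n} 3≤n u v with sum-pos avoiding 1≤count
    where
    avoiding : Fin n → ℕ
    avoiding w = ⟦ not (does (w ≟ᶠ u)) ∧ not (does (w ≟ᶠ v)) ⟧
    1≤count : 1 ≤ sum avoiding
    1≤count = +-cancelʳ-≤ 2 1 (sum avoiding) (begin
      3                                                       ≤⟨ 3≤n ⟩
      n                                                       ≡⟨ sum-others v ⟨
      1 + sum (λ w → ⟦ not (does (w ≟ᶠ v)) ⟧)                 ≡⟨ cong suc (sum-split (λ w → does (w ≟ᶠ u)) (λ w → not (does (w ≟ᶠ v)))) ⟨
      1 + (sum (λ w → ⟦ does (w ≟ᶠ u) ∧ not (does (w ≟ᶠ v)) ⟧) + sum avoiding)
        ≡⟨ cong (λ x → 1 + (x + sum avoiding)) (sum-point u (λ w → not (does (w ≟ᶠ v)))) ⟩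
      1 + (⟦ not (does (u ≟ᶠ v)) ⟧ + sum avoiding)            ≤⟨ s≤s (+-monoˡ-≤ (sum avoiding) (⟦⟧≤1 _)) ⟩
      1 + (1 + sum avoiding)                                  ≡⟨ +-comm 2 (sum avoiding) ⟩
      sum avoiding + 2                                        ∎)
      where open ≤-Reasoning
  ... | w , avoids = w , w≢ u (proj₁ (split avoids)) , w≢ v (proj₂ (split avoids))
    where
    split : ∀ {a b} → 1 ≤ ⟦ not a ∧ not b ⟧ → a ≡ false × b ≡ false
    split {false} {false} _ = refl , refl
    w≢ : ∀ x → does (w ≟ᶠ x) ≡ false → w ≢ x
    w≢ x neq refl with w ≟ᶠ w in eq
    ... | yes _ = case neq of λ ()
    ... | no w≢w = w≢w refl

  countTrue-++ : ∀ {A : Set} (t : A → Bool) xs ys →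
    countTrue (map t (xs ++ ys)) ≡ countTrue (map t xs) + countTrue (map t ys)
  countTrue-++ t []       ys = refl
  countTrue-++ t (x ∷ xs) ys with t x
  ... | true  = cong suc (countTrue-++ t xs ys)
  ... | false = countTrue-++ t xs ys

  countTrue-tabulate : ∀ {A : Set} {n} (t : A → Bool) (f : Fin n → A) →
    countTrue (map t (tabulate f)) ≡ sum (λ u → ⟦ t (f u) ⟧)
  countTrue-tabulate {n = zero}  t f = refl
  countTrue-tabulate {n = suc n} t f with t (f fzero)
  ... | true  = cong suc (countTrue-tabulate t (f ∘ fsuc))
  ... | false = countTrue-tabulate t (f ∘ fsuc)

  countTrue-concatMap : ∀ {A B : Set} {n} (t : B → Bool) (h : A → List B) (f : Fin n → A) →
    countTrue (map t (concatMap h (tabulate f))) ≡ sum (λ u → countTrue (map t (h (f u))))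
  countTrue-concatMap {n = zero}  t h f = refl
  countTrue-concatMap {n = suc n} t h f =
    trans (countTrue-++ t (h (f fzero)) _) (cong (_ +_) (countTrue-concatMap t h (f ∘ fsuc)))

  countTrue-pairs : ∀ {n} (t : Fin n × Fin n → Bool) →
    countTrue (map t (pairs n)) ≡ sum (λ u → sum (λ v → ⟦ (toℕ u <ᵇ toℕ v) ∧ t (u , v) ⟧))
  countTrue-pairs {n} t = trans (countTrue-concatMap t row id) (sum-cong-≗ λ u →
    trans (countTrue-concatMap t (entry u) id) (sum-cong-≗ λ v → singleton (toℕ u <ᵇ toℕ v) (u , v)))
    where
    entry : Fin n → Fin n → List (Fin n × Fin n)
    entry u v = if toℕ u <ᵇ toℕ v then (u , v) ∷ [] else []
    row : Fin n → List (Fin n × Fin n)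
    row u = concatMap (entry u) (tabulate id)
    singleton : ∀ b p → countTrue (map t (if b then p ∷ [] else [])) ≡ ⟦ b ∧ t p ⟧
    singleton false p = refl
    singleton true  p with t p
    ... | true  = refl
    ... | false = refl

  -- Degrees and edge counts

  _<ᶠ_ : ∀ {n} → Fin n → Fin n → Bool
  u <ᶠ v = toℕ u <ᵇ toℕ v

  <ᶠ-true : ∀ {n} {u v : Fin n} → toℕ u < toℕ v → (u <ᶠ v) ≡ true
  <ᶠ-true u<v = T⇒≡true (<⇒<ᵇ u<v)

  <ᶠ-false : ∀ {n} {u v : Fin n} → ¬ toℕ u < toℕ v → (u <ᶠ v) ≡ false
  <ᶠ-false {u = u} {v} u≮v with u <ᶠ v in eq
  ... | false = refl
  ... | true  = ⊥-elim (u≮v (<ᵇ⇒< (toℕ u) (toℕ v) (≡true⇒T eq)))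

  module _ {n} (t : Fin n → Fin n → Bool)
           (t-sym : ∀ u v → t u v ≡ t v u) (t-irrefl : ∀ u → t u u ≡ false) where

    private
      ⟦t⟧-split : ∀ u v → ⟦ t u v ⟧ ≡ ⟦ (u <ᶠ v) ∧ t u v ⟧ + ⟦ (v <ᶠ u) ∧ t u v ⟧
      ⟦t⟧-split u v with <-cmp (toℕ u) (toℕ v)
      ... | tri< u<v _ v≮u rewrite <ᶠ-true {u = u} {v} u<v | <ᶠ-false {u = v} {u} v≮u = sym (+-identityʳ _)
      ... | tri> u≮v _ v<u rewrite <ᶠ-true {u = v} {u} v<u | <ᶠ-false {u = u} {v} u≮v = refl
      ... | tri≈ u≮v u≡v _ rewrite toℕ-injective u≡v | t-irrefl v | <ᶠ-false {u = v} {v} u≮v = refl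

    sum-symmetric : sum (λ u → sum (λ v → ⟦ t u v ⟧)) ≡ 2 * sum (λ u → sum (λ v → ⟦ (u <ᶠ v) ∧ t u v ⟧))
    sum-symmetric = begin
      sum (λ u → sum (λ v → ⟦ t u v ⟧))
        ≡⟨ sum-cong-≗ (λ u → trans (sum-cong-≗ (⟦t⟧-split u)) (∑-distrib-+ (upper u) (lower u))) ⟩
      sum (λ u → sum (upper u) + sum (lower u))
        ≡⟨ ∑-distrib-+ (λ u → sum (upper u)) (λ u → sum (lower u)) ⟩
      U + sum (λ u → sum (lower u))
        ≡⟨ cong (U +_) (trans (∑-comm lower) (sum-cong-≗ λ v → sum-cong-≗ λ u → cong (λ b → ⟦ (v <ᶠ u) ∧ b ⟧) (t-sym u v))) ⟩
      U + U
        ≡⟨ cong (U +_) (sym (+-identityʳ U)) ⟩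
      2 * U ∎
      where
      open ≡-Reasoning
      upper lower : Fin n → Fin n → ℕ
      upper u v = ⟦ (u <ᶠ v) ∧ t u v ⟧
      lower u v = ⟦ (v <ᶠ u) ∧ t u v ⟧
      U = sum (λ u → sum (upper u))

  module _ {n} (G : Graph n) where

    degree≡sum : ∀ u → degree G u ≡ sum (λ v → ⟦ adj G u v ⟧)
    degree≡sum u = countTrue-tabulate (adj G u) id

    handshake : sum (degree G) ≡ 2 * numEdges G
    handshake = begin
      sum (degree G)                                       ≡⟨ sum-cong-≗ degree≡sum ⟩
      sum (λ u → sum (λ v → ⟦ adj G u v ⟧))                ≡⟨ sum-symmetric (adj G) (adj-sym G) (irrefl G) ⟩
      2 * sum (λ u → sum (λ v → ⟦ (u <ᶠ v) ∧ adj G u v ⟧)) ≡⟨ cong (2 *_) (countTrue-pairs (λ p → adj G (proj₁ p) (proj₂ p))) ⟨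
      2 * numEdges G                                       ∎
      where open ≡-Reasoning

    hasDegree : ℕ → Fin n → Bool
    hasDegree i u = degree G u ≡ᵇ i

    hasDegree⇒≡ : ∀ {i u} → hasDegree i u ≡ true → degree G u ≡ i
    hasDegree⇒≡ {i} {u} eq = ≡ᵇ⇒≡ (degree G u) i (≡true⇒T eq)

    #degree : ℕ → ℕ
    #degree i = sum (λ u → ⟦ hasDegree i u ⟧)

    arcs : ℕ → ℕ → ℕ
    arcs i j = sum (λ u → sum (λ v → ⟦ adj G u v ∧ (hasDegree i u ∧ hasDegree j v) ⟧))

    arcs-comm : ∀ i j → arcs i j ≡ arcs j i
    arcs-comm i j = trans (∑-comm (λ u v → ⟦ adj G u v ∧ (hasDegree i u ∧ hasDegree j v) ⟧))
      (sum-cong-≗ λ u → sum-cong-≗ λ v → cong ⟦_⟧ (cong₂ _∧_ (adj-sym G v u) (∧-comm (hasDegree i v) (hasDegree j u))))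

    private
      ijEdge : ℕ → ℕ → Fin n → Fin n → Bool
      ijEdge i j u v = adj G u v ∧ ((hasDegree i u ∧ hasDegree j v) ∨ (hasDegree j u ∧ hasDegree i v))

      ijEdge-sym : ∀ i j u v → ijEdge i j u v ≡ ijEdge i j v u
      ijEdge-sym i j u v = cong₂ _∧_ (adj-sym G u v)
        (trans (∨-comm (hasDegree i u ∧ hasDegree j v) _)
               (cong₂ _∨_ (∧-comm (hasDegree j u) _) (∧-comm (hasDegree i u) _)))

      ijEdge-irrefl : ∀ i j u → ijEdge i j u u ≡ false
      ijEdge-irrefl i j u rewrite irrefl G u = refl

      2*m≡sum : ∀ i j → 2 * m G i j ≡ sum (λ u → sum (λ v → ⟦ ijEdge i j u v ⟧))
      2*m≡sum i j = sym (trans (sum-symmetric (ijEdge i j) (ijEdge-sym i j) (ijEdge-irrefl i j))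
        (cong (2 *_) (sym (countTrue-pairs (λ p → ijEdge i j (proj₁ p) (proj₂ p))))))

      ⟦ijEdge⟧-split : ∀ {i j} → i ≢ j → ∀ u v →
        ⟦ ijEdge i j u v ⟧ ≡ ⟦ adj G u v ∧ (hasDegree i u ∧ hasDegree j v) ⟧ + ⟦ adj G v u ∧ (hasDegree i v ∧ hasDegree j u) ⟧
      ⟦ijEdge⟧-split {i} {j} i≢j u v rewrite adj-sym G v u =
        ⟦⟧-∨-disjoint (adj G u v) (hasDegree i u) (hasDegree j v) (hasDegree j u) (hasDegree i v) exclusive
        where
        exclusive : (hasDegree i u ∧ hasDegree j u) ≢ true
        exclusive both with hasDegree i u in di | hasDegree j u in dj
        ... | true | true = i≢j (trans (sym (hasDegree⇒≡ di)) (hasDegree⇒≡ dj))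

    m≡arcs : ∀ {i j} → i ≢ j → m G i j ≡ arcs i j
    m≡arcs {i} {j} i≢j = *-cancelˡ-≡ (m G i j) (arcs i j) 2 (begin
      2 * m G i j                                               ≡⟨ 2*m≡sum i j ⟩
      sum (λ u → sum (λ v → ⟦ ijEdge i j u v ⟧))
        ≡⟨ sum-cong-≗ (λ u → trans (sum-cong-≗ (⟦ijEdge⟧-split i≢j u)) (∑-distrib-+ (forward u) (backward u))) ⟩
      sum (λ u → sum (forward u) + sum (backward u))            ≡⟨ ∑-distrib-+ (λ u → sum (forward u)) (λ u → sum (backward u)) ⟩
      arcs i j + sum (λ u → sum (backward u))                   ≡⟨ cong (arcs i j +_) (∑-comm backward) ⟩
      arcs i j + arcs i j                                       ≡⟨ cong (arcs i j +_) (sym (+-identityʳ _)) ⟩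
      2 * arcs i j                                              ∎)
      where
      open ≡-Reasoning
      forward backward : Fin n → Fin n → ℕ
      forward  u v = ⟦ adj G u v ∧ (hasDegree i u ∧ hasDegree j v) ⟧
      backward u v = ⟦ adj G v u ∧ (hasDegree i v ∧ hasDegree j u) ⟧

    2*m≡arcs : ∀ i → 2 * m G i i ≡ arcs i i
    2*m≡arcs i = trans (2*m≡sum i i) (sum-cong-≗ λ u → sum-cong-≗ λ v →
      cong (λ b → ⟦ adj G u v ∧ b ⟧) (∨-idem _))

  private
    oneClass : ∀ d → 1 ≤ d → d ≤ 3 → ⟦ d ≡ᵇ 1 ⟧ + ⟦ d ≡ᵇ 2 ⟧ + ⟦ d ≡ᵇ 3 ⟧ ≡ 1
    oneClass 1 _ _ = refl
    oneClass 2 _ _ = refl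
    oneClass 3 _ _ = refl
    oneClass (suc (suc (suc (suc _)))) _ (s≤s (s≤s (s≤s ())))

    classValue : ∀ d → 1 ≤ d → d ≤ 3 → ⟦ d ≡ᵇ 1 ⟧ + 2 * ⟦ d ≡ᵇ 2 ⟧ + 3 * ⟦ d ≡ᵇ 3 ⟧ ≡ d
    classValue 1 _ _ = refl
    classValue 2 _ _ = refl
    classValue 3 _ _ = refl
    classValue (suc (suc (suc (suc _)))) _ (s≤s (s≤s (s≤s ())))

    ⟦∧⟧-partition : ∀ a c x y z → ⟦ x ⟧ + ⟦ y ⟧ + ⟦ z ⟧ ≡ 1 →
      ⟦ a ∧ c ⟧ ≡ ⟦ a ∧ (c ∧ x) ⟧ + ⟦ a ∧ (c ∧ y) ⟧ + ⟦ a ∧ (c ∧ z) ⟧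
    ⟦∧⟧-partition false _     _     _     _     _ = refl
    ⟦∧⟧-partition true  false _     _     _     _ = refl
    ⟦∧⟧-partition true  true  true  false false _ = refl
    ⟦∧⟧-partition true  true  false true  false _ = refl
    ⟦∧⟧-partition true  true  false false true  _ = refl
    ⟦∧⟧-partition true  true  true  true  _     ()
    ⟦∧⟧-partition true  true  true  false true  ()
    ⟦∧⟧-partition true  true  false true  true  ()
    ⟦∧⟧-partition true  true  false false false ()

  module DegreeCounts {n} (G : Graph n) (deg∈[1,3] : ∀ u → 1 ≤ degree G u × degree G u ≤ 3) where

    private
      oneClassAt : ∀ u → ⟦ hasDegree G 1 u ⟧ + ⟦ hasDegree G 2 u ⟧ + ⟦ hasDegree G 3 u ⟧ ≡ 1
      oneClassAt u = oneClass (degree G u) (proj₁ (deg∈[1,3] u)) (proj₂ (deg∈[1,3] u))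

    vertexCount : n ≡ #degree G 1 + #degree G 2 + #degree G 3
    vertexCount = begin
      n                                                                         ≡⟨ sum-ones n ⟨
      sum {n} (λ _ → 1)                                                         ≡⟨ sum-cong-≗ oneClassAt ⟨
      sum (λ u → ⟦ hasDegree G 1 u ⟧ + ⟦ hasDegree G 2 u ⟧ + ⟦ hasDegree G 3 u ⟧)
        ≡⟨ ∑-distrib-+ (λ u → ⟦ hasDegree G 1 u ⟧ + ⟦ hasDegree G 2 u ⟧) (λ u → ⟦ hasDegree G 3 u ⟧) ⟩
      sum (λ u → ⟦ hasDegree G 1 u ⟧ + ⟦ hasDegree G 2 u ⟧) + #degree G 3
        ≡⟨ cong (_+ #degree G 3) (∑-distrib-+ (λ u → ⟦ hasDegree G 1 u ⟧) (λ u → ⟦ hasDegree G 2 u ⟧)) ⟩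
      #degree G 1 + #degree G 2 + #degree G 3                                   ∎
      where open ≡-Reasoning

    degreeSum : sum (degree G) ≡ #degree G 1 + 2 * #degree G 2 + 3 * #degree G 3
    degreeSum = begin
      sum (degree G)
        ≡⟨ sum-cong-≗ (λ u → classValue (degree G u) (proj₁ (deg∈[1,3] u)) (proj₂ (deg∈[1,3] u))) ⟨
      sum (λ u → ⟦ hasDegree G 1 u ⟧ + 2 * ⟦ hasDegree G 2 u ⟧ + 3 * ⟦ hasDegree G 3 u ⟧)
        ≡⟨ ∑-distrib-+ (λ u → ⟦ hasDegree G 1 u ⟧ + 2 * ⟦ hasDegree G 2 u ⟧) (λ u → 3 * ⟦ hasDegree G 3 u ⟧) ⟩
      sum (λ u → ⟦ hasDegree G 1 u ⟧ + 2 * ⟦ hasDegree G 2 u ⟧) + sum (λ u → 3 * ⟦ hasDegree G 3 u ⟧)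
        ≡⟨ cong₂ _+_ (∑-distrib-+ (λ u → ⟦ hasDegree G 1 u ⟧) (λ u → 2 * ⟦ hasDegree G 2 u ⟧))
                     (sym (*-distribˡ-sum 3 (λ u → ⟦ hasDegree G 3 u ⟧))) ⟩
      #degree G 1 + sum (λ u → 2 * ⟦ hasDegree G 2 u ⟧) + 3 * #degree G 3
        ≡⟨ cong (λ x → #degree G 1 + x + 3 * #degree G 3) (sym (*-distribˡ-sum 2 (λ u → ⟦ hasDegree G 2 u ⟧))) ⟩
      #degree G 1 + 2 * #degree G 2 + 3 * #degree G 3 ∎
      where open ≡-Reasoning

    row : ∀ i → i * #degree G i ≡ arcs G i 1 + arcs G i 2 + arcs G i 3
    row i = begin
      i * #degree G i                                     ≡⟨ *-distribˡ-sum i (λ u → ⟦ hasDegree G i u ⟧) ⟩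
      sum (λ u → i * ⟦ hasDegree G i u ⟧)                 ≡⟨ sum-cong-≗ star ⟩
      sum (λ u → sum (λ v → ⟦ adj G u v ∧ hasDegree G i u ⟧))
        ≡⟨ sum-cong-≗ (λ u → sum-cong-≗ λ v → ⟦∧⟧-partition (adj G u v) (hasDegree G i u) _ _ _ (oneClassAt v)) ⟩
      sum (λ u → sum (λ v → to 1 u v + to 2 u v + to 3 u v))
        ≡⟨ sum-cong-≗ (λ u → trans (∑-distrib-+ (λ v → to 1 u v + to 2 u v) (to 3 u))
                                   (cong (_+ sum (to 3 u)) (∑-distrib-+ (to 1 u) (to 2 u)))) ⟩
      sum (λ u → sum (to 1 u) + sum (to 2 u) + sum (to 3 u))
        ≡⟨ trans (∑-distrib-+ (λ u → sum (to 1 u) + sum (to 2 u)) (λ u → sum (to 3 u)))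
                 (cong (_+ arcs G i 3) (∑-distrib-+ (λ u → sum (to 1 u)) (λ u → sum (to 2 u)))) ⟩
      arcs G i 1 + arcs G i 2 + arcs G i 3                 ∎
      where
      open ≡-Reasoning
      to : ℕ → Fin n → Fin n → ℕ
      to j u v = ⟦ adj G u v ∧ (hasDegree G i u ∧ hasDegree G j v) ⟧
      star : ∀ u → i * ⟦ hasDegree G i u ⟧ ≡ sum (λ v → ⟦ adj G u v ∧ hasDegree G i u ⟧)
      star u with hasDegree G i u in di
      ... | true  = trans (*-identityʳ i) (trans (sym (hasDegree⇒≡ G di)) (trans (degree≡sum G u)
                      (sum-cong-≗ λ v → cong ⟦_⟧ (sym (∧-identityʳ (adj G u v))))))
      ... | false = trans (*-zeroʳ i) (sym (trans (sum-cong-≗ λ v → cong ⟦_⟧ (∧-zeroʳ (adj G u v))) (sum-replicate-zero n)))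

  -- Distances and parents in connected graphs

  module _ {n} (G : Graph n) where

    adj⇒degree-pos : ∀ {u v} → adj G u v ≡ true → 1 ≤ degree G u
    adj⇒degree-pos {u} {v} uv = begin
      1                             ≡⟨ cong ⟦_⟧ uv ⟨
      ⟦ adj G u v ⟧                 ≤⟨ term≤sum (λ w → ⟦ adj G u w ⟧) v ⟩
      sum (λ w → ⟦ adj G u w ⟧)     ≡⟨ degree≡sum G u ⟨
      degree G u                    ∎
      where open ≤-Reasoning

    connected⇒degree-pos : Connected G → ∀ {u w} → w ≢ u → 1 ≤ degree G u
    connected⇒degree-pos conn {u} {w} w≢u with conn u w
    ... | here       = ⊥-elim (w≢u refl)
    ... | step uv _  = adj⇒degree-pos uv

    leaf-neighbour-unique : ∀ {u y z} → degree G u ≤ 1 → adj G u y ≡ true → adj G u z ≡ true → y ≡ z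
    leaf-neighbour-unique {u} {y} {z} leaf uy uz with y ≟ᶠ z
    ... | yes y≡z = y≡z
    ... | no  y≢z = ⊥-elim (1+n≰n (begin
      2                             ≤⟨ two≤sum (λ w → ⟦ adj G u w ⟧) y≢z (≤-reflexive (cong ⟦_⟧ (sym uy))) (≤-reflexive (cong ⟦_⟧ (sym uz))) ⟩
      sum (λ w → ⟦ adj G u w ⟧)     ≡⟨ degree≡sum G u ⟨
      degree G u                    ≤⟨ leaf ⟩
      1                             ∎))
      where open ≤-Reasoning

    leaf-edge-closed : ∀ {u v} → adj G u v ≡ true → degree G u ≤ 1 → degree G v ≤ 1 →
      ∀ {x w} → x ≡ u ⊎ x ≡ v → Reachable G x w → w ≡ u ⊎ w ≡ v
    leaf-edge-closed uv u-leaf v-leaf x∈ here = x∈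
    leaf-edge-closed uv u-leaf v-leaf (inj₁ refl) (step ux rest) =
      leaf-edge-closed uv u-leaf v-leaf (inj₂ (leaf-neighbour-unique u-leaf ux uv)) rest
    leaf-edge-closed {u} {v} uv u-leaf v-leaf (inj₂ refl) (step vx rest) =
      leaf-edge-closed uv u-leaf v-leaf (inj₁ (leaf-neighbour-unique v-leaf vx (trans (adj-sym G v u) uv))) rest

    no-leaf-edges : Connected G → 3 ≤ n → m G 1 1 ≡ 0
    no-leaf-edges conn 3≤n = *-cancelˡ-≡ (m G 1 1) 0 2 (trans (2*m≡arcs G 1)
      (sum-≡0 (λ u → sum (leafArc u)) λ u → sum-≡0 (leafArc u) (no-arc u)))
      where
      leafArc : Fin n → Fin n → ℕ
      leafArc u v = ⟦ adj G u v ∧ (hasDegree G 1 u ∧ hasDegree G 1 v) ⟧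
      no-arc : ∀ u v → leafArc u v ≡ 0
      no-arc u v with adj G u v in uv | hasDegree G 1 u in u-leaf | hasDegree G 1 v in v-leaf
      ... | false | _     | _     = refl
      ... | true  | false | _     = refl
      ... | true  | true  | false = refl
      ... | true  | true  | true  with avoid-two 3≤n u v
      ...   | w , w≢u , w≢v with leaf-edge-closed uv (≤-reflexive (hasDegree⇒≡ G u-leaf))
                                    (≤-reflexive (hasDegree⇒≡ G v-leaf)) (inj₁ refl) (conn u w)
      ...     | inj₁ w≡u = ⊥-elim (w≢u w≡u)
      ...     | inj₂ w≡v = ⊥-elim (w≢v w≡v)

  least-upward-closed : (P : ℕ → Bool) → (∀ k → P k ≡ true → P (suc k) ≡ true) →
    ∀ K → P K ≡ true → ∃ λ d → P d ≡ true × (∀ k → P k ≡ true → d ≤ k)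
  least-upward-closed P up zero    PK = 0 , PK , λ _ _ → z≤n
  least-upward-closed P up (suc K) PK with P K in PK′
  ... | true  = least-upward-closed P up K PK′
  ... | false = suc K , PK , λ k Pk → ≰⇒> λ k≤K → case trans (sym (lift (≤⇒≤′ k≤K) Pk)) PK′ of λ ()
    where
    lift : ∀ {k l} → k ≤′ l → P k ≡ true → P l ≡ true
    lift ≤′-refl        Pk = Pk
    lift (≤′-step k≤l) Pk = up _ (lift k≤l Pk)

  module ShortestPaths {n} (G : Graph n) (conn : Connected G) (r : Fin n) where

    -- within k v: some walk of length at most k leads from r to v
    within : ℕ → Fin n → Bool
    within zero    v = does (v ≟ᶠ r)
    within (suc k) v = within k v ∨ does (any? λ w → T? (within k w ∧ adj G w v))

    within-suc : ∀ k {v} → within k v ≡ true → within (suc k) v ≡ true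
    within-suc k kv rewrite kv = refl

    within-step : ∀ k {u v} → within k u ≡ true → adj G u v ≡ true → within (suc k) v ≡ true
    within-step k {u} {v} ku uv with within k v
    ... | true  = refl
    ... | false = witness⇒does (any? λ w → T? (within k w ∧ adj G w v)) (u , ≡true⇒T (cong₂ _∧_ ku uv))

    within-reachable : ∀ {u v} → Reachable G u v → ∀ k → within k u ≡ true → ∃ λ l → within l v ≡ true
    within-reachable here           k ku = k , ku
    within-reachable (step uw rest) k ku = within-reachable rest (suc k) (within-step k ku uw)

    private
      distance : ∀ v → ∃ λ d → within d v ≡ true × (∀ k → within k v ≡ true → d ≤ k)
      distance v with within-reachable (conn r v) 0 (witness⇒does (r ≟ᶠ r) refl)
      ... | K , Kv = least-upward-closed (λ k → within k v) (λ k → within-suc k) K Kv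

    dist : Fin n → ℕ
    dist v = proj₁ (distance v)

    within-dist : ∀ v → within (dist v) v ≡ true
    within-dist v = proj₁ (proj₂ (distance v))

    dist-minimal : ∀ {k} v → within k v ≡ true → dist v ≤ k
    dist-minimal {k} v = proj₂ (proj₂ (distance v)) k

    dist-root : dist r ≡ 0
    dist-root = n≤0⇒n≡0 (dist-minimal r (witness⇒does (r ≟ᶠ r) refl))

    dist≡0⇒root : ∀ {v} → dist v ≡ 0 → v ≡ r
    dist≡0⇒root {v} d≡0 = does⇒witness (v ≟ᶠ r) (subst (λ k → within k v ≡ true) d≡0 (within-dist v))

    dist-adj : ∀ {u v} → adj G u v ≡ true → dist v ≤ suc (dist u)
    dist-adj {u} {v} uv = dist-minimal v (within-step (dist u) (within-dist u) uv)

    predecessor : ∀ {v} → v ≢ r → ∃ λ w → adj G w v ≡ true × suc (dist w) ≡ dist v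
    predecessor {v} v≢r with dist v in dv
    ... | zero  = ⊥-elim (v≢r (dist≡0⇒root dv))
    ... | suc j with within j v in jv
    ...   | true  = ⊥-elim (1+n≰n (subst (_≤ j) dv (dist-minimal v jv)))
    ...   | false with does⇒witness (any? λ w → T? (within j w ∧ adj G w v)) reached
      where
      reached : does (any? λ w → T? (within j w ∧ adj G w v)) ≡ true
      reached = subst (λ b → (b ∨ does (any? λ w → T? (within j w ∧ adj G w v))) ≡ true) jv
                      (subst (λ k → within k v ≡ true) dv (within-dist v))
    ...     | w , jw∧wv with ∧-true (T⇒≡true jw∧wv)
    ...       | jw , wv = w , wv , cong suc (≤-antisym (dist-minimal w jw)
                                      (s≤s⁻¹ (subst (_≤ suc (dist w)) dv (dist-adj wv))))

    -- the root is its own parent; this value is never used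
    parent : Fin n → Fin n
    parent v with v ≟ᶠ r
    ... | yes _   = r
    ... | no v≢r = proj₁ (predecessor v≢r)

    parent-adj : ∀ {v} → v ≢ r → adj G (parent v) v ≡ true
    parent-adj {v} v≢r with v ≟ᶠ r
    ... | yes v≡r  = ⊥-elim (v≢r v≡r)
    ... | no v≢r′ = proj₁ (proj₂ (predecessor v≢r′))

    parent-dist : ∀ {v} → v ≢ r → suc (dist (parent v)) ≡ dist v
    parent-dist {v} v≢r with v ≟ᶠ r
    ... | yes v≡r  = ⊥-elim (v≢r v≡r)
    ... | no v≢r′ = proj₂ (proj₂ (predecessor v≢r′))

  module RootedTree {n} (G : Graph n) (conn : Connected G) (r : Fin n) (edges : numEdges G ≡ n ∸ 1) where
    open ShortestPaths G conn r public

    infix 7 _parentOf_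
    _parentOf_ : Fin n → Fin n → Bool
    u parentOf v = does (u ≟ᶠ parent v) ∧ not (does (v ≟ᶠ r))

    parentOf-parent : ∀ {v} → v ≢ r → parent v parentOf v ≡ true
    parentOf-parent {v} v≢r = cong₂ _∧_ (witness⇒does (parent v ≟ᶠ parent v) refl)
                                        (cong not (does-false (v ≟ᶠ r) v≢r))

    parentOf⇒ : ∀ {u v} → u parentOf v ≡ true → u ≡ parent v × v ≢ r
    parentOf⇒ {u} {v} uv with ∧-true uv
    ... | u≡p , v≢r = does⇒witness (u ≟ᶠ parent v) u≡p , λ v≡r → not-true (v ≟ᶠ r) v≢r v≡r

    parentOf⇒adj : ∀ {u v} → u parentOf v ≡ true → adj G u v ≡ true
    parentOf⇒adj {u} {v} uv with parentOf⇒ uv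
    ... | u≡p , v≢r = subst (λ w → adj G w v ≡ true) (sym u≡p) (parent-adj v≢r)

    parentOf⇒dist : ∀ {u v} → u parentOf v ≡ true → dist v ≡ suc (dist u)
    parentOf⇒dist {u} {v} uv with parentOf⇒ uv
    ... | u≡p , v≢r = trans (sym (parent-dist v≢r)) (cong (suc ∘ dist) (sym u≡p))

    parentOf-asym : ∀ u v → (u parentOf v ∧ v parentOf u) ≢ true
    parentOf-asym u v both with ∧-true {u parentOf v} {v parentOf u} both
    ... | uv , vu = 1+n≰n (≤-trans (n≤1+n _) (≤-reflexive (sym (trans (parentOf⇒dist {v} {u} vu) (cong suc (parentOf⇒dist {u} {v} uv))))))

    treeEdge : Fin n → Fin n → Bool
    treeEdge u v = u parentOf v ∨ v parentOf u

    private
      parentOf-total : sum (λ u → sum (λ v → ⟦ u parentOf v ⟧)) ≡ n ∸ 1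
      parentOf-total = begin
        sum (λ u → sum (λ v → ⟦ u parentOf v ⟧))  ≡⟨ ∑-comm (λ u v → ⟦ u parentOf v ⟧) ⟩
        sum (λ v → sum (λ u → ⟦ u parentOf v ⟧))  ≡⟨ sum-cong-≗ (λ v → sum-point (parent v) (λ _ → not (does (v ≟ᶠ r)))) ⟩
        sum (λ v → ⟦ not (does (v ≟ᶠ r)) ⟧)        ≡⟨ m+n∸m≡n 1 _ ⟨
        1 + sum (λ v → ⟦ not (does (v ≟ᶠ r)) ⟧) ∸ 1 ≡⟨ cong (_∸ 1) (sum-others r) ⟩
        n ∸ 1                                      ∎
        where open ≡-Reasoning

      treeEdge-total : sum (λ u → sum (λ v → ⟦ treeEdge u v ⟧)) ≡ 2 * (n ∸ 1)
      treeEdge-total = begin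
        sum (λ u → sum (λ v → ⟦ treeEdge u v ⟧))
          ≡⟨ sum-cong-≗ (λ u → trans (sum-cong-≗ λ v → ⟦⟧-∨ (u parentOf v) (v parentOf u) (parentOf-asym u v))
                                     (∑-distrib-+ (λ v → ⟦ u parentOf v ⟧) (λ v → ⟦ v parentOf u ⟧))) ⟩
        sum (λ u → sum (λ v → ⟦ u parentOf v ⟧) + sum (λ v → ⟦ v parentOf u ⟧))
          ≡⟨ ∑-distrib-+ (λ u → sum (λ v → ⟦ u parentOf v ⟧)) (λ u → sum (λ v → ⟦ v parentOf u ⟧)) ⟩
        sum (λ u → sum (λ v → ⟦ u parentOf v ⟧)) + sum (λ u → sum (λ v → ⟦ v parentOf u ⟧))
          ≡⟨ cong₂ _+_ parentOf-total (trans (∑-comm (λ u v → ⟦ v parentOf u ⟧)) parentOf-total) ⟩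
        (n ∸ 1) + (n ∸ 1)                          ≡⟨ cong ((n ∸ 1) +_) (+-identityʳ (n ∸ 1)) ⟨
        2 * (n ∸ 1)                                ∎
        where open ≡-Reasoning

      adj-total : sum (λ u → sum (λ v → ⟦ adj G u v ⟧)) ≡ 2 * (n ∸ 1)
      adj-total = trans (sym (sum-cong-≗ (degree≡sum G))) (trans (handshake G) (cong (2 *_) edges))

      treeEdge≤adj : ∀ u v → ⟦ treeEdge u v ⟧ ≤ ⟦ adj G u v ⟧
      treeEdge≤adj u v with u parentOf v in uv | v parentOf u in vu
      ... | true  | _     rewrite parentOf⇒adj {u} {v} uv = ≤-refl
      ... | false | true  rewrite adj-sym G u v | parentOf⇒adj {v} {u} vu = ≤-refl
      ... | false | false = z≤n

    -- n - 1 parent links, all of them edges, exhaust the n - 1 edges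
    adj≡treeEdge : ∀ u v → adj G u v ≡ treeEdge u v
    adj≡treeEdge u v = sym (⟦⟧-injective (sum-mono-≡ (treeEdge≤adj u)
      (sum-mono-≡ (λ u → sum-mono (treeEdge≤adj u)) (trans treeEdge-total (sym adj-total)) u) v))

    sum-adj-symmetric : (X : Fin n → Fin n → Bool) → (∀ u v → X u v ≡ X v u) →
      sum (λ u → sum (λ v → ⟦ adj G u v ∧ X u v ⟧)) ≡ 2 * sum (λ v → ⟦ not (does (v ≟ᶠ r)) ∧ X (parent v) v ⟧)
    sum-adj-symmetric X X-sym = begin
      sum (λ u → sum (λ v → ⟦ adj G u v ∧ X u v ⟧))
        ≡⟨ sum-cong-≗ (λ u → trans (sum-cong-≗ λ v → trans (cong (λ b → ⟦ b ∧ X u v ⟧) (adj≡treeEdge u v))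
                                      (⟦⟧-∨∧ (u parentOf v) (v parentOf u) (X u v) (parentOf-asym u v)))
                                   (∑-distrib-+ (down u) (up u))) ⟩
      sum (λ u → sum (down u) + sum (up u))
        ≡⟨ ∑-distrib-+ (λ u → sum (down u)) (λ u → sum (up u)) ⟩
      sum (λ u → sum (down u)) + sum (λ u → sum (up u))
        ≡⟨ cong (sum (λ u → sum (down u)) +_) (trans (∑-comm up) (sum-cong-≗ λ u → sum-cong-≗ λ v →
             cong (λ b → ⟦ u parentOf v ∧ b ⟧) (X-sym v u))) ⟩
      sum (λ u → sum (down u)) + sum (λ u → sum (down u))
        ≡⟨ cong (sum (λ u → sum (down u)) +_) (+-identityʳ _) ⟨
      2 * sum (λ u → sum (down u))
        ≡⟨ cong (2 *_) (trans (∑-comm down) (sum-cong-≗ λ v → trans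
             (sum-cong-≗ λ u → cong ⟦_⟧ (∧-assoc (does (u ≟ᶠ parent v)) (not (does (v ≟ᶠ r))) (X u v)))
             (sum-point (parent v) (λ u → not (does (v ≟ᶠ r)) ∧ X u v)))) ⟩
      2 * sum (λ v → ⟦ not (does (v ≟ᶠ r)) ∧ X (parent v) v ⟧) ∎
      where
      open ≡-Reasoning
      down up : Fin n → Fin n → ℕ
      down u v = ⟦ u parentOf v ∧ X u v ⟧
      up   u v = ⟦ v parentOf u ∧ X u v ⟧

    degree≡children+1 : ∀ u → degree G u ≡ sum (λ v → ⟦ u parentOf v ⟧) + ⟦ not (does (u ≟ᶠ r)) ⟧
    degree≡children+1 u = begin
      degree G u                                                  ≡⟨ degree≡sum G u ⟩
      sum (λ v → ⟦ adj G u v ⟧)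
        ≡⟨ sum-cong-≗ (λ v → trans (cong ⟦_⟧ (adj≡treeEdge u v)) (⟦⟧-∨ (u parentOf v) (v parentOf u) (parentOf-asym u v))) ⟩
      sum (λ v → ⟦ u parentOf v ⟧ + ⟦ v parentOf u ⟧)             ≡⟨ ∑-distrib-+ (λ v → ⟦ u parentOf v ⟧) (λ v → ⟦ v parentOf u ⟧) ⟩
      sum (λ v → ⟦ u parentOf v ⟧) + sum (λ v → ⟦ v parentOf u ⟧)
        ≡⟨ cong (sum (λ v → ⟦ u parentOf v ⟧) +_) (sum-point (parent u) (λ _ → not (does (u ≟ᶠ r)))) ⟩
      sum (λ v → ⟦ u parentOf v ⟧) + ⟦ not (does (u ≟ᶠ r)) ⟧      ∎
      where open ≡-Reasoning

    -- every 33-edge is the parent edge of a non-root vertex of degree 3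
    m33<#degree3 : hasDegree G 3 r ≡ true → m G 3 3 < #degree G 3
    m33<#degree3 r3 = begin-strict
      m G 3 3                                                       ≡⟨ m33≡ ⟩
      sum (λ v → ⟦ not (does (v ≟ᶠ r)) ∧ (h3 (parent v) ∧ h3 v) ⟧)  ≤⟨ sum-mono (λ v → ⟦⟧-∧-weaken (not (does (v ≟ᶠ r))) (h3 (parent v)) (h3 v)) ⟩
      sum (λ v → ⟦ not (does (v ≟ᶠ r)) ∧ h3 v ⟧)                    <⟨ s≤s ≤-refl ⟩
      1 + sum (λ v → ⟦ not (does (v ≟ᶠ r)) ∧ h3 v ⟧)                ≡⟨ cong (λ b → ⟦ b ⟧ + sum (λ v → ⟦ not (does (v ≟ᶠ r)) ∧ h3 v ⟧)) r3 ⟨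
      ⟦ h3 r ⟧ + sum (λ v → ⟦ not (does (v ≟ᶠ r)) ∧ h3 v ⟧)         ≡⟨ cong (_+ sum (λ v → ⟦ not (does (v ≟ᶠ r)) ∧ h3 v ⟧)) (sum-point r h3) ⟨
      sum (λ v → ⟦ does (v ≟ᶠ r) ∧ h3 v ⟧) + sum (λ v → ⟦ not (does (v ≟ᶠ r)) ∧ h3 v ⟧)
                                                                    ≡⟨ sum-split (λ v → does (v ≟ᶠ r)) h3 ⟩
      #degree G 3                                                   ∎
      where
      open ≤-Reasoning
      h3 = hasDegree G 3
      m33≡ : m G 3 3 ≡ sum (λ v → ⟦ not (does (v ≟ᶠ r)) ∧ (h3 (parent v) ∧ h3 v) ⟧)
      m33≡ = *-cancelˡ-≡ _ _ 2 (trans (2*m≡arcs G 3) (sum-adj-symmetric (λ u v → h3 u ∧ h3 v) (λ u v → ∧-comm (h3 u) (h3 v))))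

  injective⇒surjective : ∀ {n} (f : Fin n → Fin n) → (∀ {x y} → f x ≡ f y → x ≡ y) → ∀ k → ∃ λ v → f v ≡ k
  injective⇒surjective {zero}  f f-inj ()
  injective⇒surjective {suc n} f f-inj k with any? (λ v → f v ≟ᶠ k)
  ... | yes hit = hit
  ... | no miss = ⊥-elim (1+n≰n (injective⇒≤ {f = g} g-inj))
    where
    g : Fin (suc n) → Fin n
    g v = punchOut {i = k} (λ k≡fv → miss (v , sym k≡fv))
    g-inj : ∀ {x y} → g x ≡ g y → x ≡ y
    g-inj {x} {y} gx≡gy = f-inj (punchOut-injective {i = k} _ _ gx≡gy)

  module PathShapedTree {n} (G : Graph n) (conn : Connected G) (r : Fin n) (edges : numEdges G ≡ n ∸ 1)
                        (r-leaf : degree G r ≡ 1) (degree≤2 : ∀ u → degree G u ≤ 2) where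
    open RootedTree G conn r edges

    children≤1 : ∀ u → sum (λ v → ⟦ u parentOf v ⟧) ≤ 1
    children≤1 u with u ≟ᶠ r
    ... | yes refl = ≤-trans (m≤m+n _ _) (≤-reflexive (trans (sym (degree≡children+1 r)) r-leaf))
    ... | no u≢r  = +-cancelʳ-≤ 1 _ 1 (begin
      sum (λ v → ⟦ u parentOf v ⟧) + 1                        ≡⟨ cong (λ b → sum (λ v → ⟦ u parentOf v ⟧) + ⟦ not b ⟧) (does-false (u ≟ᶠ r) u≢r) ⟨
      sum (λ v → ⟦ u parentOf v ⟧) + ⟦ not (does (u ≟ᶠ r)) ⟧  ≡⟨ degree≡children+1 u ⟨
      degree G u                                              ≤⟨ degree≤2 u ⟩
      2                                                       ∎)
      where open ≤-Reasoning

    child-unique : ∀ {u v v′} → u parentOf v ≡ true → u parentOf v′ ≡ true → v ≡ v′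
    child-unique {u} {v} {v′} uv uv′ with v ≟ᶠ v′
    ... | yes v≡v′ = v≡v′
    ... | no  v≢v′ = ⊥-elim (1+n≰n (≤-trans (two≤sum (λ w → ⟦ u parentOf w ⟧) v≢v′
                        (≤-reflexive (cong ⟦_⟧ (sym uv))) (≤-reflexive (cong ⟦_⟧ (sym uv′)))) (children≤1 u)))

    private
      off-root : ∀ {v j} → dist v ≡ suc j → v ≢ r
      off-root {v} {j} dv refl = 0≢1+n (trans (sym dist-root) dv)

    -- one vertex per level: by induction, two vertices on level j + 1 have the same parent
    level-unique : ∀ j {v v′} → dist v ≡ j → dist v′ ≡ j → v ≡ v′
    level-unique zero    dv dv′ = trans (dist≡0⇒root dv) (sym (dist≡0⇒root dv′))
    level-unique (suc j) {v} {v′} dv dv′ =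
      child-unique {parent v} (parentOf-parent v≢r) (subst (λ w → w parentOf v′ ≡ true) (sym same-parent) (parentOf-parent v′≢r))
      where
      v≢r = off-root dv
      v′≢r = off-root dv′
      same-parent : parent v ≡ parent v′
      same-parent = level-unique j (suc-injective (trans (parent-dist v≢r) dv))
                                   (suc-injective (trans (parent-dist v′≢r) dv′))

    ancestor : ℕ → Fin n → Fin n
    ancestor zero    v = v
    ancestor (suc k) v = ancestor k (parent v)

    dist-ancestor : ∀ k v → k ≤ dist v → dist (ancestor k v) ≡ dist v ∸ k
    dist-ancestor zero    v _ = refl
    dist-ancestor (suc k) v k<d with dist v in dv
    ... | suc d = trans (dist-ancestor k (parent v) (subst (k ≤_) (sym dp) (s≤s⁻¹ k<d))) (cong (_∸ k) dp)
      where
      dp : dist (parent v) ≡ d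
      dp = suc-injective (trans (parent-dist (off-root dv)) dv)

    -- the ancestors of v occupy the dist v + 1 levels 0, …, dist v
    dist<n : ∀ v → dist v < n
    dist<n v = injective⇒≤ {f = onLevel} onLevel-injective
      where
      onLevel : Fin (suc (dist v)) → Fin n
      onLevel i = ancestor (dist v ∸ toℕ i) v
      dist-onLevel : ∀ i → dist (onLevel i) ≡ toℕ i
      dist-onLevel i = trans (dist-ancestor (dist v ∸ toℕ i) v (m∸n≤m (dist v) (toℕ i)))
                             (m∸[m∸n]≡n (s≤s⁻¹ (toℕ<n i)))
      onLevel-injective : ∀ {i j} → onLevel i ≡ onLevel j → i ≡ j
      onLevel-injective {i} {j} eq = toℕ-injective (trans (sym (dist-onLevel i)) (trans (cong dist eq) (dist-onLevel j)))

    level : Fin n → Fin n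
    level v = fromℕ< (dist<n v)

    toℕ-level : ∀ v → toℕ (level v) ≡ dist v
    toℕ-level v = toℕ-fromℕ< (dist<n v)

    level-injective : ∀ {v v′} → level v ≡ level v′ → v ≡ v′
    level-injective {v} {v′} eq = level-unique (dist v′) (trans (sym (toℕ-level v)) (trans (cong toℕ eq) (toℕ-level v′))) refl

    parentOf≡ : ∀ u v → u parentOf v ≡ (dist v ≡ᵇ suc (dist u))
    parentOf≡ u v with dist v ≡ᵇ suc (dist u) in du
    ... | true = subst (λ w → w parentOf v ≡ true) parent≡u (parentOf-parent v≢r)
      where
      dv : dist v ≡ suc (dist u)
      dv = ≡ᵇ⇒≡ (dist v) (suc (dist u)) (≡true⇒T du)
      v≢r = off-root dv
      parent≡u : parent v ≡ u
      parent≡u = level-unique (dist u) (suc-injective (trans (parent-dist v≢r) dv)) refl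
    ... | false with u parentOf v in uv
    ...   | false = refl
    ...   | true  = case trans (sym du) (T⇒≡true (≡⇒≡ᵇ _ _ (parentOf⇒dist {u} {v} uv))) of λ ()

    ≅path : G ≅ path n
    ≅path = record { bij = mk↔ₛ′ level unlevel (λ k → proj₂ (onto k)) (λ v → level-injective (proj₂ (onto (level v))))
                   ; preserve = preserve }
      where
      onto : ∀ k → ∃ λ v → level v ≡ k
      onto = injective⇒surjective level level-injective
      unlevel : Fin n → Fin n
      unlevel k = proj₁ (onto k)
      preserve : ∀ u v → adj (path n) (level u) (level v) ≡ adj G u v
      preserve u v rewrite toℕ-level u | toℕ-level v | adj≡treeEdge u v | parentOf≡ u v | parentOf≡ v u =
        ∨-comm (dist u ≡ᵇ suc (dist v)) (dist v ≡ᵇ suc (dist u))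

  -- The path

  private
    ≡ᵇ-sym : ∀ a b → (a ≡ᵇ b) ≡ (b ≡ᵇ a)
    ≡ᵇ-sym zero    zero    = refl
    ≡ᵇ-sym zero    (suc b) = refl
    ≡ᵇ-sym (suc a) zero    = refl
    ≡ᵇ-sym (suc a) (suc b) = ≡ᵇ-sym a b

    ≡ᵇ-refl : ∀ a → (a ≡ᵇ a) ≡ true
    ≡ᵇ-refl zero    = refl
    ≡ᵇ-refl (suc a) = ≡ᵇ-refl a

    <ᵇ∧pathAdj : ∀ a b → (a <ᵇ b) ∧ ((a ≡ᵇ suc b) ∨ (b ≡ᵇ suc a)) ≡ (b ≡ᵇ suc a)
    <ᵇ∧pathAdj zero    zero    = refl
    <ᵇ∧pathAdj zero    (suc b) = refl
    <ᵇ∧pathAdj (suc a) zero    = refl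
    <ᵇ∧pathAdj (suc a) (suc b) = <ᵇ∧pathAdj a b

    #toℕ≡-≤1 : ∀ {n} k → sum {n} (λ u → ⟦ toℕ u ≡ᵇ k ⟧) ≤ 1
    #toℕ≡-≤1 {zero}  k       = z≤n
    #toℕ≡-≤1 {suc n} zero    = ≤-reflexive (cong suc (sum-≡0 {n} (λ u → ⟦ toℕ (fsuc u) ≡ᵇ 0 ⟧) λ _ → refl))
    #toℕ≡-≤1 {suc n} (suc k) = #toℕ≡-≤1 {n} k

    #toℕ≡ : ∀ {n} k → k < n → sum {n} (λ u → ⟦ toℕ u ≡ᵇ k ⟧) ≡ 1
    #toℕ≡ {suc n} zero    _       = cong suc (sum-≡0 {n} (λ u → ⟦ toℕ (fsuc u) ≡ᵇ 0 ⟧) λ _ → refl)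
    #toℕ≡ {suc n} (suc k) (s≤s k<n) = #toℕ≡ {n} k k<n

  module _ (n : ℕ) where

    path-degree≤2 : ∀ u → degree (path n) u ≤ 2
    path-degree≤2 u = begin
      degree (path n) u                                 ≡⟨ degree≡sum (path n) u ⟩
      sum {n} (λ v → ⟦ pathAdj u v ⟧)                       ≤⟨ sum-mono {n} (λ v → ⟦⟧-∨-≤ (toℕ u ≡ᵇ suc (toℕ v)) (toℕ v ≡ᵇ suc (toℕ u))) ⟩
      sum {n} (λ v → ⟦ toℕ u ≡ᵇ suc (toℕ v) ⟧ + ⟦ toℕ v ≡ᵇ suc (toℕ u) ⟧)
        ≡⟨ ∑-distrib-+ {n} (λ v → ⟦ toℕ u ≡ᵇ suc (toℕ v) ⟧) (λ v → ⟦ toℕ v ≡ᵇ suc (toℕ u) ⟧) ⟩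
      sum {n} (λ v → ⟦ toℕ u ≡ᵇ suc (toℕ v) ⟧) + sum {n} (λ v → ⟦ toℕ v ≡ᵇ suc (toℕ u) ⟧)
        ≤⟨ +-mono-≤ (predecessors (toℕ u)) (#toℕ≡-≤1 {n} (suc (toℕ u))) ⟩
      2                                                 ∎
      where
      open ≤-Reasoning
      predecessors : ∀ k → sum {n} (λ v → ⟦ k ≡ᵇ suc (toℕ v) ⟧) ≤ 1
      predecessors zero    = ≤-trans (≤-reflexive (sum-≡0 {n} (λ v → ⟦ zero ≡ᵇ suc (toℕ v) ⟧) λ _ → refl)) z≤n
      predecessors (suc k) = ≤-trans (≤-reflexive (sum-cong-≗ {n} λ v → cong ⟦_⟧ (≡ᵇ-sym k (toℕ v)))) (#toℕ≡-≤1 {n} k)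

    path-edges : numEdges (path n) ≡ n ∸ 1
    path-edges = begin
      numEdges (path n)
        ≡⟨ countTrue-pairs {n} (λ p → pathAdj (proj₁ p) (proj₂ p)) ⟩
      sum {n} (λ u → sum {n} (λ v → ⟦ (toℕ u <ᵇ toℕ v) ∧ pathAdj u v ⟧))
        ≡⟨ sum-cong-≗ {n} (λ u → sum-cong-≗ {n} λ v → cong ⟦_⟧ (<ᵇ∧pathAdj (toℕ u) (toℕ v))) ⟩
      sum {n} (λ u → sum {n} (λ v → ⟦ toℕ v ≡ᵇ suc (toℕ u) ⟧))
        ≡⟨ ∑-comm {n} {n} (λ u v → ⟦ toℕ v ≡ᵇ suc (toℕ u) ⟧) ⟩
      sum {n} (λ v → sum {n} (λ u → ⟦ toℕ v ≡ᵇ suc (toℕ u) ⟧))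
        ≡⟨ by-predecessor n ≤-refl ⟩
      n ∸ 1                                             ∎
      where
      open ≡-Reasoning
      -- vertex 0 has no predecessor, every other vertex exactly one
      by-predecessor : ∀ m → m ≤ n → sum {m} (λ v → sum {n} (λ u → ⟦ toℕ v ≡ᵇ suc (toℕ u) ⟧)) ≡ m ∸ 1
      by-predecessor zero    _   = refl
      by-predecessor (suc m) m<n = begin
        sum {n} (λ u → ⟦ 0 ≡ᵇ suc (toℕ u) ⟧) + sum {m} (λ w → sum {n} (λ u → ⟦ toℕ w ≡ᵇ toℕ u ⟧))
          ≡⟨ cong₂ _+_ (sum-≡0 {n} (λ u → ⟦ 0 ≡ᵇ suc (toℕ u) ⟧) (λ _ → refl))
                       (sum-cong-≗ {m} λ w → trans (sum-cong-≗ {n} λ u → cong ⟦_⟧ (≡ᵇ-sym (toℕ w) (toℕ u)))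
                                                   (#toℕ≡ {n} (toℕ w) (≤-trans (toℕ<n w) (≤-trans (n≤1+n m) m<n)))) ⟩
        sum {m} (λ _ → 1)                             ≡⟨ sum-ones m ⟩
        m                                             ∎

  Reachable-trans : ∀ {n} {G : Graph n} {u v w} → Reachable G u v → Reachable G v w → Reachable G u w
  Reachable-trans here          vw = vw
  Reachable-trans (step ux xv)  vw = step ux (Reachable-trans xv vw)

  Reachable-sym : ∀ {n} {G : Graph n} {u v} → Reachable G u v → Reachable G v u
  Reachable-sym             here         = here
  Reachable-sym {G = G} (step ux xv) = Reachable-trans (Reachable-sym xv) (step (trans (adj-sym G _ _) ux) here)

  path-connected : ∀ n → Connected (path n)
  path-connected (suc n) u v = Reachable-trans (toZero (toℕ u) u refl) (Reachable-sym (toZero (toℕ v) v refl))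
    where
    toZero : ∀ k (u : Fin (suc n)) → toℕ u ≡ k → Reachable (path (suc n)) u fzero
    toZero _       fzero    _  = here
    toZero (suc k) (fsuc w) eq = step down (toZero k (inject₁ w) (trans (toℕ-inject₁ w) (suc-injective eq)))
      where
      down : pathAdj (fsuc w) (inject₁ w) ≡ true
      down rewrite toℕ-inject₁ w | ≡ᵇ-refl (toℕ w) = refl

  path-isChemTree : ∀ n → IsChemTree n (path n)
  path-isChemTree n = path-connected n , (λ u → ≤-trans (path-degree≤2 n u) (n≤1+n 2)) , path-edges n

  path-unbranched : ∀ n → #degree (path n) 3 ≡ 0
  path-unbranched n = sum-≡0 (λ u → ⟦ hasDegree (path n) 3 u ⟧) λ u → not3 (degree (path n) u) (path-degree≤2 n u)
    where
    not3 : ∀ d → d ≤ 2 → ⟦ d ≡ᵇ 3 ⟧ ≡ 0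
    not3 0 _ = refl
    not3 1 _ = refl
    not3 2 _ = refl
    not3 (suc (suc (suc _))) (s≤s (s≤s ()))

  -- Count vectors

  record Counts : Set where
    constructor counts
    field m₁₂ m₁₃ m₂₂ m₂₃ m₃₃ : ℕ

  infixl 6 _⊕_
  _⊕_ : Counts → Counts → Counts
  counts a b c d e ⊕ counts a′ b′ c′ d′ e′ = counts (a + a′) (b + b′) (c + c′) (d + d′) (e + e′)

  infixr 7 _⊛_
  _⊛_ : ℕ → Counts → Counts
  k ⊛ counts a b c d e = counts (k * a) (k * b) (k * c) (k * d) (k * e)

  countsOf : ∀ {n} → Graph n → Counts
  countsOf G = counts (m G 1 2) (m G 1 3) (m G 2 2) (m G 2 3) (m G 3 3)

  counts-≡ : ∀ {a b c d e a′ b′ c′ d′ e′} → a ≡ a′ → b ≡ b′ → c ≡ c′ → d ≡ d′ → e ≡ e′ →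
    counts a b c d e ≡ counts a′ b′ c′ d′ e′
  counts-≡ refl refl refl refl refl = refl

  -- weight (heavier g b e) − weight (lighter g b e) = g (− c′₁₂) + b (c′₁₂ − c′₁₃) + e (− c′₁₂ − c′₃₃)
  lighter heavier : ℕ → ℕ → ℕ → Counts
  lighter g b e = g ⊛ counts 1 0 0 3 0 ⊕ b ⊛ counts 0 1 4 2 0 ⊕ e ⊛ counts 1 0 1 3 1
  heavier g b e = g ⊛ counts 0 0 4 0 0 ⊕ b ⊛ counts 1 0 3 3 0 ⊕ e ⊛ counts 0 0 4 2 0

  balance : ∀ {a b c d e f t} →
    a + b ≡ e + suc f + 2 → b + d + 2 * e ≡ 3 * (e + suc f) → a + b + c + d + e + 1 ≡ t + 3 →
    counts a b c d e ⊕ heavier (suc f) b e ≡ counts 2 0 t 0 0 ⊕ lighter (suc f) b e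
  balance {a} {b} {c} {d} {e} {f} {t} h₁ h₂ h₃ = counts-≡
    (begin
      a + ((suc f * 0 + b * 1) + e * 0)    ≡⟨ solve (a ∷ b ∷ e ∷ f ∷ []) ⟩
      a + b                                ≡⟨ h₁ ⟩
      e + suc f + 2                        ≡⟨ solve (b ∷ e ∷ f ∷ []) ⟩
      2 + ((suc f * 1 + b * 0) + e * 1)    ∎)
    (begin
      b + ((suc f * 0 + b * 0) + e * 0)    ≡⟨ solve (b ∷ e ∷ f ∷ []) ⟩
      0 + ((suc f * 0 + b * 1) + e * 0)    ∎)
    (+-cancelʳ-≡ (e + suc f + 2 + 3 * (e + suc f) + (t + 3)) _ _ (begin
      c + ((suc f * 4 + b * 3) + e * 4) + (e + suc f + 2 + 3 * (e + suc f) + (t + 3))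
        ≡⟨ cong (λ x → c + ((suc f * 4 + b * 3) + e * 4) + x) (cong₂ (λ x y → x + y + (t + 3)) h₁ h₂) ⟨
      c + ((suc f * 4 + b * 3) + e * 4) + (a + b + (b + d + 2 * e) + (t + 3))
        ≡⟨ solve (a ∷ b ∷ c ∷ d ∷ e ∷ f ∷ t ∷ []) ⟩
      t + ((suc f * 0 + b * 4) + e * 1) + (e + suc f + 2 + 3 * (e + suc f) + (a + b + c + d + e + 1))
        ≡⟨ cong (λ x → t + ((suc f * 0 + b * 4) + e * 1) + (e + suc f + 2 + 3 * (e + suc f) + x)) h₃ ⟩
      t + ((suc f * 0 + b * 4) + e * 1) + (e + suc f + 2 + 3 * (e + suc f) + (t + 3)) ∎))
    (+-cancelʳ-≡ (3 * (e + suc f)) _ _ (begin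
      d + ((suc f * 0 + b * 3) + e * 2) + 3 * (e + suc f)   ≡⟨ solve (b ∷ d ∷ e ∷ f ∷ []) ⟩
      0 + ((suc f * 3 + b * 2) + e * 3) + (b + d + 2 * e)   ≡⟨ cong (0 + ((suc f * 3 + b * 2) + e * 3) +_) h₂ ⟩
      0 + ((suc f * 3 + b * 2) + e * 3) + 3 * (e + suc f)   ∎))
    (begin
      e + ((suc f * 0 + b * 0) + e * 0)    ≡⟨ solve (b ∷ e ∷ f ∷ []) ⟩
      0 + ((suc f * 0 + b * 0) + e * 1)    ∎)
    where open ≡-Reasoning

  counts-unbranched : ∀ {a b c d e t} →
    a + b ≡ 0 + 2 → b + d + 2 * e ≡ 3 * 0 → a + b + c + d + e + 1 ≡ t + 3 → counts a b c d e ≡ counts 2 0 t 0 0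
  counts-unbranched {a} {b} {c} {d} {e} {t} h₁ h₂ h₃
    with m+n≡0⇒m≡0 b (m+n≡0⇒m≡0 (b + d) h₂) | m+n≡0⇒n≡0 b (m+n≡0⇒m≡0 (b + d) h₂) | m+n≡0⇒m≡0 e (m+n≡0⇒n≡0 (b + d) h₂)
  ... | refl | refl | refl with trans (≡.sym (+-identityʳ a)) h₁
  ...   | refl = counts-≡ refl refl (+-cancelʳ-≡ 3 c t (begin
        c + 3                    ≡⟨ solve (c ∷ []) ⟩
        2 + 0 + c + 0 + 0 + 1    ≡⟨ h₃ ⟩
        t + 3                    ∎)) refl refl
    where open ≡-Reasoning

  -- Chemical trees

  module ChemicalTree {n} (G : Graph n) (tree : IsChemTree n G) (3≤n : 3 ≤ n) where

    private
      conn = proj₁ tree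
      maxDegree = proj₁ (proj₂ tree)
      edges = proj₂ (proj₂ tree)

      deg∈[1,3] : ∀ u → 1 ≤ degree G u × degree G u ≤ 3
      deg∈[1,3] u = connected⇒degree-pos G conn (proj₁ (proj₂ (avoid-two 3≤n u u))) , maxDegree u

      open DegreeCounts G deg∈[1,3]

      n₁ = #degree G 1
      n₂ = #degree G 2
      n₃ = #degree G 3
      m₁₂ = m G 1 2
      m₁₃ = m G 1 3
      m₂₂ = m G 2 2
      m₂₃ = m G 2 3
      m₃₃ = m G 3 3

      row₁ : n₁ ≡ m₁₂ + m₁₃
      row₁ = begin
        n₁                                     ≡⟨ +-identityʳ n₁ ⟨
        1 * n₁                                 ≡⟨ row 1 ⟩
        arcs G 1 1 + arcs G 1 2 + arcs G 1 3   ≡⟨ cong₂ (λ x y → x + y + arcs G 1 3) arcs₁₁ (sym (m≡arcs G (λ ()))) ⟩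
        m₁₂ + arcs G 1 3                       ≡⟨ cong (m₁₂ +_) (m≡arcs G (λ ())) ⟨
        m₁₂ + m₁₃                              ∎
        where
        open ≡-Reasoning
        arcs₁₁ : arcs G 1 1 ≡ 0
        arcs₁₁ = trans (sym (2*m≡arcs G 1)) (cong (2 *_) (no-leaf-edges G conn 3≤n))

      row₂ : 2 * n₂ ≡ m₁₂ + 2 * m₂₂ + m₂₃
      row₂ = begin
        2 * n₂                                 ≡⟨ row 2 ⟩
        arcs G 2 1 + arcs G 2 2 + arcs G 2 3
          ≡⟨ cong₂ (λ x y → x + y + arcs G 2 3) (trans (arcs-comm G 2 1) (sym (m≡arcs G (λ ())))) (sym (2*m≡arcs G 2)) ⟩
        m₁₂ + 2 * m₂₂ + arcs G 2 3             ≡⟨ cong (m₁₂ + 2 * m₂₂ +_) (m≡arcs G (λ ())) ⟨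
        m₁₂ + 2 * m₂₂ + m₂₃                    ∎
        where open ≡-Reasoning

      row₃ : 3 * n₃ ≡ m₁₃ + m₂₃ + 2 * m₃₃
      row₃ = begin
        3 * n₃                                 ≡⟨ row 3 ⟩
        arcs G 3 1 + arcs G 3 2 + arcs G 3 3
          ≡⟨ cong₂ (λ x y → x + y + arcs G 3 3) (trans (arcs-comm G 3 1) (sym (m≡arcs G (λ ()))))
                                                 (trans (arcs-comm G 3 2) (sym (m≡arcs G (λ ())))) ⟩
        m₁₃ + m₂₃ + arcs G 3 3                 ≡⟨ cong (m₁₃ + m₂₃ +_) (2*m≡arcs G 3) ⟨
        m₁₃ + m₂₃ + 2 * m₃₃                    ∎
        where open ≡-Reasoning

      degree-total : n₁ + 2 * n₂ + 3 * n₃ + 2 ≡ 2 * n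
      degree-total = begin
        n₁ + 2 * n₂ + 3 * n₃ + 2               ≡⟨ cong (_+ 2) (trans (sym degreeSum) (trans (handshake G) (cong (2 *_) edges))) ⟩
        2 * (n ∸ 1) + 2                        ≡⟨ *-distribˡ-+ 2 (n ∸ 1) 1 ⟨
        2 * (n ∸ 1 + 1)                        ≡⟨ cong (2 *_) (m∸n+n≡m (≤-trans (s≤s z≤n) 3≤n)) ⟩
        2 * n                                  ∎
        where open ≡-Reasoning

    leaf-count : m₁₂ + m₁₃ ≡ n₃ + 2
    leaf-count = trans (sym row₁) (+-cancelˡ-≡ (n₁ + 2 * n₂ + 2 * n₃) n₁ (n₃ + 2) (begin
      n₁ + 2 * n₂ + 2 * n₃ + n₁     ≡⟨ lemma₁ n₁ n₂ n₃ ⟩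
      2 * (n₁ + n₂ + n₃)            ≡⟨ cong (2 *_) vertexCount ⟨
      2 * n                         ≡⟨ degree-total ⟨
      n₁ + 2 * n₂ + 3 * n₃ + 2      ≡⟨ lemma₂ n₁ n₂ n₃ ⟩
      n₁ + 2 * n₂ + 2 * n₃ + (n₃ + 2) ∎))
      where
      open ≡-Reasoning
      lemma₁ : ∀ x y z → x + 2 * y + 2 * z + x ≡ 2 * (x + y + z)
      lemma₁ = solve-∀
      lemma₂ : ∀ x y z → x + 2 * y + 3 * z + 2 ≡ x + 2 * y + 2 * z + (z + 2)
      lemma₂ = solve-∀

    branch-ends : m₁₃ + m₂₃ + 2 * m₃₃ ≡ 3 * n₃
    branch-ends = sym row₃

    edge-count : m₁₂ + m₁₃ + m₂₂ + m₂₃ + m₃₃ + 1 ≡ n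
    edge-count = trans (cong (_+ 1) (*-cancelˡ-≡ _ (n ∸ 1) 2 (begin
      2 * (m₁₂ + m₁₃ + m₂₂ + m₂₃ + m₃₃)                              ≡⟨ lemma m₁₂ m₁₃ m₂₂ m₂₃ m₃₃ ⟩
      (m₁₂ + m₁₃) + (m₁₂ + 2 * m₂₂ + m₂₃) + (m₁₃ + m₂₃ + 2 * m₃₃)     ≡⟨ cong₂ (λ x y → x + y + (m₁₃ + m₂₃ + 2 * m₃₃)) row₁ row₂ ⟨
      n₁ + 2 * n₂ + (m₁₃ + m₂₃ + 2 * m₃₃)                            ≡⟨ cong (n₁ + 2 * n₂ +_) row₃ ⟨
      n₁ + 2 * n₂ + 3 * n₃                                           ≡⟨ trans (sym degreeSum) (trans (handshake G) (cong (2 *_) edges)) ⟩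
      2 * (n ∸ 1)                                                    ∎)))
      (m∸n+n≡m (≤-trans (s≤s z≤n) 3≤n))
      where
      open ≡-Reasoning
      lemma : ∀ a b c d e → 2 * (a + b + c + d + e) ≡ (a + b) + (a + 2 * c + d) + (b + d + 2 * e)
      lemma = solve-∀

    m₃₃<n₃ : 1 ≤ n₃ → m₃₃ < n₃
    m₃₃<n₃ 1≤n₃ with sum-pos (λ u → ⟦ hasDegree G 3 u ⟧) 1≤n₃
    ... | r , r3 = RootedTree.m33<#degree3 G conn r edges (⟦⟧-≥1 r3)

    n₃≡0⇒≅path : n₃ ≡ 0 → G ≅ path n
    n₃≡0⇒≅path n₃≡0
      with sum-pos (λ u → ⟦ hasDegree G 1 u ⟧) (subst (1 ≤_) (sym (trans row₁ (trans leaf-count (cong (_+ 2) n₃≡0)))) (s≤s z≤n))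
    ... | r , r1 = PathShapedTree.≅path G conn r edges (hasDegree⇒≡ G (⟦⟧-≥1 r1)) degree≤2
      where
      degree≤2 : ∀ u → degree G u ≤ 2
      degree≤2 u with hasDegree G 3 u in u3
      ... | true  = ⊥-elim (1+n≰n (≤-trans (≤-reflexive (cong ⟦_⟧ (sym u3)))
                      (≤-trans (term≤sum (λ v → ⟦ hasDegree G 3 v ⟧) u) (≤-reflexive n₃≡0))))
      ... | false with m≤n⇒m<n∨m≡n (maxDegree u)
      ...   | inj₁ <3 = s≤s⁻¹ <3
      ...   | inj₂ ≡3 = case trans (sym u3) (T⇒≡true (≡⇒≡ᵇ _ _ ≡3)) of λ ()

    unbranched-counts : n₃ ≡ 0 → countsOf G ≡ counts 2 0 (n ∸ 3) 0 0
    unbranched-counts n₃≡0 = counts-unbranched {m₁₂} {m₁₃} {m₂₂} {m₂₃} {m₃₃}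
      (trans leaf-count (cong (_+ 2) n₃≡0)) (trans branch-ends (cong (3 *_) n₃≡0)) (trans edge-count (sym (m∸n+n≡m 3≤n)))

    branched-balance : ∀ {k} → n₃ ≡ suc k →
      ∃ λ f → countsOf G ⊕ heavier (suc f) m₁₃ m₃₃ ≡ counts 2 0 (n ∸ 3) 0 0 ⊕ lighter (suc f) m₁₃ m₃₃
    branched-balance {k} n₃≡1+k = k ∸ m₃₃ ,
      balance {m₁₂} {m₁₃} {m₂₂} {m₂₃} {m₃₃} {k ∸ m₃₃}
        (trans leaf-count (cong (_+ 2) n₃≡)) (trans branch-ends (cong (3 *_) n₃≡)) (trans edge-count (sym (m∸n+n≡m 3≤n)))
      where
      m₃₃≤k : m₃₃ ≤ k
      m₃₃≤k = s≤s⁻¹ (subst (m₃₃ <_) n₃≡1+k (m₃₃<n₃ (subst (1 ≤_) (sym n₃≡1+k) (s≤s z≤n))))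
      n₃≡ : n₃ ≡ m₃₃ + suc (k ∸ m₃₃)
      n₃≡ = trans n₃≡1+k (sym (trans (+-suc m₃₃ (k ∸ m₃₃)) (cong suc (m+[n∸m]≡n m₃₃≤k))))


module OrderedFieldLemmas {a ℓ : Level} (F : OrderedField a ℓ) where
  open Combinatorics using (Counts; counts; _⊕_; _⊛_; lighter; heavier)
  open import Relation.Binary.PropositionalEquality using (_≡_)
  open import Relation.Binary.Structures using (IsStrictTotalOrder)
  open import Relation.Binary.Bundles using (StrictPartialOrder)
  open OrderedField F
  open IsStrictTotalOrder isStrictTotalOrder using (<-resp-≈) renaming (trans to <-trans)
  open import Algebra.Solver.CommutativeMonoid +-commutativeMonoid using (solve; _⊜_) renaming (_⊕_ to infixl 6 _⊞_; id to ∅)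

  strictPartialOrder : StrictPartialOrder a ℓ ℓ
  strictPartialOrder = record { isStrictPartialOrder = IsStrictTotalOrder.isStrictPartialOrder isStrictTotalOrder }

  <-respʳ-≈ : ∀ {x y y′} → y ≈ y′ → x < y → x < y′
  <-respʳ-≈ = proj₁ <-resp-≈

  <-respˡ-≈ : ∀ {x x′ y} → x ≈ x′ → x < y → x′ < y
  <-respˡ-≈ = proj₂ <-resp-≈

  +-monoʳ-< : ∀ {x y} z → x < y → z + x < z + y
  +-monoʳ-< {x} {y} z x<y = <-respˡ-≈ (+-comm x z) (<-respʳ-≈ (+-comm y z) (+-mono-< z x<y))

  +-monoʳ-≤ : ∀ {x y} z → x ≤ y → z + x ≤ z + y
  +-monoʳ-≤ z (inj₁ x<y) = inj₁ (+-monoʳ-< z x<y)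
  +-monoʳ-≤ z (inj₂ x≈y) = inj₂ (+-congˡ x≈y)

  +-monoˡ-≤ : ∀ {x y} z → x ≤ y → x + z ≤ y + z
  +-monoˡ-≤ z (inj₁ x<y) = inj₁ (+-mono-< z x<y)
  +-monoˡ-≤ z (inj₂ x≈y) = inj₂ (+-congʳ x≈y)

  <-≤-trans : ∀ {x y z} → x < y → y ≤ z → x < z
  <-≤-trans x<y (inj₁ y<z) = <-trans x<y y<z
  <-≤-trans x<y (inj₂ y≈z) = <-respʳ-≈ y≈z x<y

  ≤-trans : ∀ {x y z} → x ≤ y → y ≤ z → x ≤ z
  ≤-trans (inj₁ x<y) y≤z        = inj₁ (<-≤-trans x<y y≤z)
  ≤-trans (inj₂ x≈y) (inj₁ y<z) = inj₁ (<-respˡ-≈ (sym x≈y) y<z)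
  ≤-trans (inj₂ x≈y) (inj₂ y≈z) = inj₂ (trans x≈y y≈z)

  +-mono-<-≤ : ∀ {x y z w} → x < y → z ≤ w → x + z < y + w
  +-mono-<-≤ {y = y} x<y z≤w = <-≤-trans (+-mono-< _ x<y) (+-monoʳ-≤ y z≤w)

  +-mono-≤ : ∀ {x y z w} → x ≤ y → z ≤ w → x + z ≤ y + w
  +-mono-≤ {y = y} x≤y z≤w = ≤-trans (+-monoˡ-≤ _ x≤y) (+-monoʳ-≤ y z≤w)

  +-inverse-cancel : ∀ w y → w + (- y + y) ≈ w
  +-inverse-cancel w y = trans (+-congˡ (-‿inverseˡ y)) (+-identityʳ w)

  +-cancelʳ-< : ∀ {x y} z → x + z < y + z → x < y
  +-cancelʳ-< {x} {y} z lt = <-respʳ-≈ (cancel y) (<-respˡ-≈ (cancel x) (+-mono-< (- z) lt))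
    where
    cancel : ∀ w → w + z + - z ≈ w
    cancel w = trans (+-assoc w z (- z)) (trans (+-congˡ (-‿inverseʳ z)) (+-identityʳ w))

  ·-homo-+ : ∀ k l x → (k ℕ.+ l) · x ≈ k · x + l · x
  ·-homo-+ ℕ.zero    l x = sym (+-identityˡ (l · x))
  ·-homo-+ (ℕ.suc k) l x = trans (+-congˡ (·-homo-+ k l x)) (sym (+-assoc x (k · x) (l · x)))

  move-negatives : ∀ {x y z x′ y′ z′} → x + - y + z < x′ + - y′ + z′ → x + z + y′ < x′ + z′ + y
  move-negatives {x} {y} {z} {x′} {y′} {z′} lt =
    <-respˡ-≈ (trans (solve 5 (λ x -y z y y′ → x ⊞ -y ⊞ z ⊞ (y ⊞ y′) ⊜ x ⊞ z ⊞ y′ ⊞ (-y ⊞ y)) refl x (- y) z y y′)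
                     (+-inverse-cancel (x + z + y′) y))
    (<-respʳ-≈ (trans (solve 5 (λ x′ -y′ z′ y y′ → x′ ⊞ -y′ ⊞ z′ ⊞ (y ⊞ y′) ⊜ x′ ⊞ z′ ⊞ y ⊞ (-y′ ⊞ y′)) refl x′ (- y′) z′ y y′)
                      (+-inverse-cancel (x′ + z′ + y) y′))
    (+-mono-< (y + y′) lt))

  move-negative-<0 : ∀ {x y z} → x + - y + z < 0# → x + z < y
  move-negative-<0 {x} {y} {z} lt =
    <-respˡ-≈ (trans (solve 4 (λ x -y z y → x ⊞ -y ⊞ z ⊞ y ⊜ x ⊞ z ⊞ (-y ⊞ y)) refl x (- y) z y) (+-inverse-cancel (x + z) y))
    (<-respʳ-≈ (+-identityˡ y) (+-mono-< y lt))

  move-negatives-<0 : ∀ {x y z x′ y′ z′} → x + - y + z + (x′ + - y′ + z′) < 0# → x + z + x′ + z′ < y + y′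
  move-negatives-<0 {x} {y} {z} {x′} {y′} {z′} lt =
    <-respˡ-≈ (trans (solve 8 (λ x -y z x′ -y′ z′ y y′ → x ⊞ -y ⊞ z ⊞ (x′ ⊞ -y′ ⊞ z′) ⊞ (y ⊞ y′)
                                   ⊜ x ⊞ z ⊞ x′ ⊞ z′ ⊞ (-y ⊞ y) ⊞ (-y′ ⊞ y′)) refl x (- y) z x′ (- y′) z′ y y′)
                     (trans (+-inverse-cancel (x + z + x′ + z′ + (- y + y)) y′) (+-inverse-cancel (x + z + x′ + z′) y)))
    (<-respʳ-≈ (+-identityˡ (y + y′)) (+-mono-< (y + y′) lt))

  <-neg⇒+<0 : ∀ {x y} → x < - y → x + y < 0#
  <-neg⇒+<0 {x} {y} lt = <-respʳ-≈ (-‿inverseˡ y) (+-mono-< y lt)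

  module Weight (c₁₂ c₁₃ c₂₂ c₂₃ c₃₃ : Carrier) where

    weight : Counts → Carrier
    weight (counts a b c d e) = a · c₁₂ + b · c₁₃ + c · c₂₂ + d · c₂₃ + e · c₃₃

    weight-⊕ : ∀ u v → weight (u ⊕ v) ≈ weight u + weight v
    weight-⊕ (counts a b c d e) (counts a′ b′ c′ d′ e′) = begin
      weight (counts (a ℕ.+ a′) (b ℕ.+ b′) (c ℕ.+ c′) (d ℕ.+ d′) (e ℕ.+ e′))
        ≈⟨ +-cong (+-cong (+-cong (+-cong (·-homo-+ a a′ c₁₂) (·-homo-+ b b′ c₁₃)) (·-homo-+ c c′ c₂₂))
                          (·-homo-+ d d′ c₂₃)) (·-homo-+ e e′ c₃₃) ⟩
      (a · c₁₂ + a′ · c₁₂) + (b · c₁₃ + b′ · c₁₃) + (c · c₂₂ + c′ · c₂₂) + (d · c₂₃ + d′ · c₂₃) + (e · c₃₃ + e′ · c₃₃)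
        ≈⟨ solve 10 (λ x₁ y₁ x₂ y₂ x₃ y₃ x₄ y₄ x₅ y₅ →
                       (x₁ ⊞ y₁) ⊞ (x₂ ⊞ y₂) ⊞ (x₃ ⊞ y₃) ⊞ (x₄ ⊞ y₄) ⊞ (x₅ ⊞ y₅)
                     ⊜ (x₁ ⊞ x₂ ⊞ x₃ ⊞ x₄ ⊞ x₅) ⊞ (y₁ ⊞ y₂ ⊞ y₃ ⊞ y₄ ⊞ y₅)) refl
                   (a · c₁₂) (a′ · c₁₂) (b · c₁₃) (b′ · c₁₃) (c · c₂₂) (c′ · c₂₂) (d · c₂₃) (d′ · c₂₃) (e · c₃₃) (e′ · c₃₃) ⟩
      weight (counts a b c d e) + weight (counts a′ b′ c′ d′ e′) ∎
      where open import Relation.Binary.Reasoning.Setoid setoid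

    infix 4 _≺_ _≼_
    record _≺_ (u v : Counts) : Set ℓ where
      constructor weight<
      field lt : weight u < weight v

    record _≼_ (u v : Counts) : Set ℓ where
      constructor weight≤
      field le : weight u ≤ weight v

    ≺-⊕ : ∀ {u v u′ v′} → u ≺ v → u′ ≼ v′ → u ⊕ u′ ≺ v ⊕ v′
    ≺-⊕ {u} {v} {u′} {v′} (weight< u<v) (weight≤ u′≤v′) =
      weight< (<-respˡ-≈ (sym (weight-⊕ u u′)) (<-respʳ-≈ (sym (weight-⊕ v v′)) (+-mono-<-≤ u<v u′≤v′)))

    ≼-⊕ : ∀ {u v u′ v′} → u ≼ v → u′ ≼ v′ → u ⊕ u′ ≼ v ⊕ v′
    ≼-⊕ {u} {v} {u′} {v′} (weight≤ u≤v) (weight≤ u′≤v′) =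
      weight≤ (≤-trans (inj₂ (weight-⊕ u u′)) (≤-trans (+-mono-≤ u≤v u′≤v′) (inj₂ (sym (weight-⊕ v v′)))))

    ≼-⊛ : ∀ k {u v} → u ≺ v → k ⊛ u ≼ k ⊛ v
    ≼-⊛ ℕ.zero    _               = weight≤ (inj₂ refl)
    ≼-⊛ (ℕ.suc k) (weight< u<v) = ≼-⊕ (weight≤ (inj₁ u<v)) (≼-⊛ k (weight< u<v))

    ≺-⊛ : ∀ k {u v} → u ≺ v → ℕ.suc k ⊛ u ≺ ℕ.suc k ⊛ v
    ≺-⊛ k u≺v = ≺-⊕ u≺v (≼-⊛ k u≺v)

    ≺-cancel : ∀ {t p u v} → t ⊕ v ≡ p ⊕ u → u ≺ v → t ≺ p
    ≺-cancel {t} {p} {u} {v} t⊕v≡p⊕u (weight< u<v) = weight< (+-cancelʳ-< (weight v) (begin-strict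
      weight t + weight v     ≈⟨ weight-⊕ t v ⟨
      weight (t ⊕ v)          ≡⟨ ≡.cong weight t⊕v≡p⊕u ⟩
      weight (p ⊕ u)          ≈⟨ weight-⊕ p u ⟩
      weight p + weight u     <⟨ +-monoʳ-< (weight p) u<v ⟩
      weight p + weight v     ∎))
      where open import Relation.Binary.Reasoning.StrictPartialOrder strictPartialOrder

    c′₁₂ c′₁₃ c′₃₃ : Carrier
    c′₁₂ = c₁₂ + - (4 · c₂₂) + 3 · c₂₃
    c′₁₃ = c₁₃ + - (3 · c₂₂) + 2 · c₂₃
    c′₃₃ = c₂₂ + - (2 · c₂₃) + c₃₃

    c′₁₂<0⇒ : c′₁₂ < 0# → counts 1 0 0 3 0 ≺ counts 0 0 4 0 0
    c′₁₂<0⇒ lt = weight< (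
      <-respˡ-≈ (sym (solve 2 (λ x y → x ⊞ ∅ ⊞ ∅ ⊞ ∅ ⊞ y ⊞ ∅ ⊜ x ⊞ y) refl c₁₂ (3 · c₂₃)))
      (<-respʳ-≈ (sym (solve 1 (λ x → ∅ ⊞ ∅ ⊞ x ⊞ ∅ ⊞ ∅ ⊜ x) refl (4 · c₂₂)))
      (move-negative-<0 lt)))

    c′₁₃<c′₁₂⇒ : c′₁₃ < c′₁₂ → counts 0 1 4 2 0 ≺ counts 1 0 3 3 0
    c′₁₃<c′₁₂⇒ lt = weight< (
      <-respˡ-≈ (sym (solve 3 (λ x y z → ∅ ⊞ (x ⊞ ∅) ⊞ z ⊞ y ⊞ ∅ ⊜ x ⊞ y ⊞ z) refl c₁₃ (2 · c₂₃) (4 · c₂₂)))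
      (<-respʳ-≈ (sym (solve 3 (λ x y z → x ⊞ ∅ ⊞ ∅ ⊞ z ⊞ y ⊞ ∅ ⊜ x ⊞ y ⊞ z) refl c₁₂ (3 · c₂₃) (3 · c₂₂)))
      (move-negatives lt)))

    c′₁₂+c′₃₃<0⇒ : c′₁₂ + c′₃₃ < 0# → counts 1 0 1 3 1 ≺ counts 0 0 4 2 0
    c′₁₂+c′₃₃<0⇒ lt = weight< (
      <-respˡ-≈ (sym (solve 4 (λ x y z w → x ⊞ ∅ ⊞ ∅ ⊞ (z ⊞ ∅) ⊞ y ⊞ (w ⊞ ∅) ⊜ x ⊞ y ⊞ z ⊞ w) refl c₁₂ (3 · c₂₃) c₂₂ c₃₃))
      (<-respʳ-≈ (sym (solve 2 (λ x y → ∅ ⊞ ∅ ⊞ x ⊞ y ⊞ ∅ ⊜ x ⊞ y) refl (4 · c₂₂) (2 · c₂₃)))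
      (move-negatives-<0 lt)))

    lighter≺heavier : c′₁₃ < c′₁₂ → c′₁₂ < - c′₃₃ → - c′₃₃ < 0# →
      ∀ f b e → lighter (ℕ.suc f) b e ≺ heavier (ℕ.suc f) b e
    lighter≺heavier h₁ h₂ h₃ f b e =
      ≺-⊕ (≺-⊕ (≺-⊛ f (c′₁₂<0⇒ (<-trans h₂ h₃))) (≼-⊛ b (c′₁₃<c′₁₂⇒ h₁))) (≼-⊛ e (c′₁₂+c′₃₃<0⇒ (<-neg⇒+<0 h₂)))

theorem1 : ∀ {c ℓ : Level} (F : OrderedField c ℓ) →
    let open OrderedField F in
    (n : ℕ) → n ≥ 3 →
    (c12 c13 c22 c23 c33 : Carrier) →
    let c12′ = c12 + (- (4 · c22)) + 3 · c23
        c13′ = c13 + (- (3 · c22)) + 2 · c23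
        c33′ = c22 + (- (2 · c23)) + c33
    in c13′ < c12′ → c12′ < - c33′ → - c33′ < 0# →
    IsChemTree n (path n) ×
    ((T : Graph n) → IsChemTree n T →
      (index F c12 c13 c22 c23 c33 T ≤ index F c12 c13 c22 c23 c33 (path n))
      × (¬ (T ≅ path n) → index F c12 c13 c22 c23 c33 T < index F c12 c13 c22 c23 c33 (path n)))
theorem1 F n n≥3 c12 c13 c22 c23 c33 c′₁₃<c′₁₂ c′₁₂<-c′₃₃ -c′₃₃<0 = path-isChemTree n , compare
  where
  open OrderedField F
  open OrderedFieldLemmas F
  open Weight c12 c13 c22 c23 c33
  open Combinatorics using (counts; countsOf; path-isChemTree; path-unbranched; #degree; module ChemicalTree)

  path-counts : countsOf (path n) ≡.≡ counts 2 0 (n ℕ.∸ 3) 0 0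
  path-counts = ChemicalTree.unbranched-counts (path n) (path-isChemTree n) n≥3 (path-unbranched n)

  compare : (T : Graph n) → IsChemTree n T →
    (weight (countsOf T) ≤ weight (countsOf (path n))) × (¬ (T ≅ path n) → weight (countsOf T) < weight (countsOf (path n)))
  compare T T-tree with #degree T 3 in n₃
  ... | ℕ.zero  = inj₂ (reflexive (≡.cong weight (≡.trans (unbranched-counts n₃) (≡.sym path-counts))))
                , λ T≇path → ⊥-elim (T≇path (n₃≡0⇒≅path n₃))
    where open ChemicalTree T T-tree n≥3
  ... | ℕ.suc k = inj₁ T<path , λ _ → T<path
    where
    open ChemicalTree T T-tree n≥3
    balanced = branched-balance n₃
    T<path : weight (countsOf T) < weight (countsOf (path n))
    T<path = _≺_.lt (≡.subst (countsOf T ≺_) (≡.sym path-counts)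
      (≺-cancel (proj₂ balanced) (lighter≺heavier c′₁₃<c′₁₂ c′₁₂<-c′₃₃ -c′₃₃<0 (proj₁ balanced) (m T 1 3) (m T 3 3))))
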